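{- For every two rooted phylogenies (triplet version), or every two unrooted phylogenies (quartet version), $T_1$ and $T_2$ over the same set of taxa, $$d_{\mathrm{Haus}}(T_1,T_2)\ge |\mathcal{D}(T_1,T_2)|+\frac{2}{3}\max\{|\mathcal{R}_1(T_1,T_2)|,|\mathcal{R}_2(T_1,T_2)|\}.$$
   Context: Rooted phylogeny: rooted tree with leaf set the taxon set, internal nodes with at least two children, resolved if exactly two. Unrooted phylogeny: internal nodes of degree at least $3$, resolved if degree $3$. Fully resolved: all internal nodes resolved. $T|X$: minimal subtree containing $X$ with degree-two nodes suppressed (except the root in the rooted case). Units: triplets (3-subsets) for rooted, quartets (4-subsets) for unrooted; a unit $X$ is resolved in $T$ if $T|X$ is fully resolved. $\mathcal{D}(T_1,T_2)$: units resolved in both with $T_1|X\ne T_2|X$; $\mathcal{R}_1(T_1,T_2)$: units resolved in $T_1$ but not $T_2$; $\mathcal{R}_2(T_1,T_2)$: units resolved in $T_2$ but not $T_1$. A contraction deletes an internal edge and identifies its endpoints; $T'$ refines $T$ if $T$ arises from $T'$ by zero or more contractions; $\mathcal{F}(T)$ is the set of fully resolved refinements of $T$. For fully resolved $t_1,t_2$, $d(t_1,t_2)=|\mathcal{D}(t_1,t_2)|$ (triplet or quartet distance). $d_{\mathrm{Haus}}(T_1,T_2)=\max\{\max_{t_1\in\mathcal{F}(T_1)}\min_{t_2\in\mathcal{F}(T_2)}d(t_1,t_2),\ \max_{t_2\in\mathcal{F}(T_2)}\min_{t_1\in\mathcal{F}(T_1)}d(t_1,t_2)\}$. -}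

module Defs where

open import Data.Bool using (Bool; true; false; _∧_; _∨_; not)
import Data.Bool.Properties as BoolP
open import Data.Nat using (ℕ; zero; suc; _⊔_; _⊓_; _≡ᵇ_; _≤ᵇ_)
open import Data.List using (List; []; _∷_; [_]; map; _++_; filter; length; foldr)
open import Data.Bool.ListAction using (all; any)
open import Data.Vec using ([]; _∷_)
import Data.Vec.Properties as VecP
open import Data.Fin using (Fin)
open import Data.Fin.Subset using (Subset; _∩_; ∁; ⊥; ⊤; ⁅_⁆; ∣_∣)
open import Data.List using () renaming (allFin to allFinL)
open import Relation.Nullary.Decidable using (isYes)

subsets : (n : ℕ) → List (Subset n)
subsets zero    = [ [] ]
subsets (suc n) = map (false ∷_) (subsets n) ++ map (true ∷_) (subsets n)

sublists : {A : Set} → List A → List (List A)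
sublists []       = [ [] ]
sublists (x ∷ xs) = sublists xs ++ map (x ∷_) (sublists xs)

module _ {n : ℕ} where

  _==_ : Subset n → Subset n → Bool
  A == B = isYes (VecP.≡-dec BoolP._≟_ A B)

  _⊆ᵇ_ : Subset n → Subset n → Bool
  A ⊆ᵇ B = (A ∩ B) == A

  _⊂ᵇ_ : Subset n → Subset n → Bool
  A ⊂ᵇ B = (A ⊆ᵇ B) ∧ not (A == B)

  disjointᵇ : Subset n → Subset n → Bool
  disjointᵇ A B = (A ∩ B) == ⊥

  countSubsets : (Subset n → Bool) → ℕ
  countSubsets P = length (filter (λ X → BoolP.T? (P X)) (subsets n))

  ofSize : ℕ → Subset n → Bool
  ofSize k X = ∣ X ∣ ≡ᵇ k

  pairsOf : Subset n → List (Subset n)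
  pairsOf X = filter (λ Y → BoolP.T? ((Y ⊆ᵇ X) ∧ ofSize 2 Y)) (subsets n)

-- Rooted phylogenies, encoded (as usual) by their set of clusters
-- (leaf sets below the nodes).  A collection of clusters is a list of
-- subsets; only membership matters.

Clusters : ℕ → Set
Clusters n = List (Subset n)

module _ {n : ℕ} where

  _∈ᶜ_ : Subset n → Clusters n → Bool
  A ∈ᶜ H = any (A ==_) H

  -- hierarchy: contains the full taxon set, all singletons, not ∅,
  -- and any two clusters are nested or disjoint.  These are exactly
  -- the cluster sets of rooted phylogenies on Fin n.
  isHierarchy : Clusters n → Bool
  isHierarchy H =
    (⊤ ∈ᶜ H) ∧ all (λ i → ⁅ i ⁆ ∈ᶜ H) (allFinL n) ∧ not (⊥ ∈ᶜ H) ∧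
    all (λ A → all (λ B → (A ⊆ᵇ B) ∨ (B ⊆ᵇ A) ∨ disjointᵇ A B) H) H

  isChild : Clusters n → Subset n → Subset n → Bool
  isChild H C D =
    (D ∈ᶜ H) ∧ (D ⊂ᵇ C) ∧
    not (any (λ E → (E ∈ᶜ H) ∧ (D ⊂ᵇ E) ∧ (E ⊂ᵇ C)) (subsets n))

  numChildren : Clusters n → Subset n → ℕ
  numChildren H C = countSubsets (isChild H C)

  isFullyResolved : Clusters n → Bool
  isFullyResolved H =
    all (λ C → not (C ∈ᶜ H) ∨ (∣ C ∣ ≤ᵇ 1) ∨ (numChildren H C ≡ᵇ 2)) (subsets n)

  -- H' refines H (H arises from H' by contracting internal edges)
  -- iff every cluster of H is a cluster of H'
  refines : Clusters n → Clusters n → Bool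
  refines H' H = all (λ C → not (C ∈ᶜ H) ∨ (C ∈ᶜ H')) (subsets n)

  𝓕 : Clusters n → List (Clusters n)
  𝓕 H = filter (λ H' → BoolP.T?
           (isHierarchy H' ∧ isFullyResolved H' ∧ refines H' H))
         (sublists (subsets n))

maxList : List ℕ → ℕ
maxList = foldr _⊔_ 0

minList : List ℕ → ℕ
minList []       = 0
minList (x ∷ xs) = foldr _⊓_ x xs

dHausWith : {n : ℕ} → (Clusters n → Clusters n → ℕ) →
            Clusters n → Clusters n → ℕ
dHausWith d T₁ T₂ =
  maxList (map (λ t₁ → minList (map (λ t₂ → d t₁ t₂) (𝓕 T₂))) (𝓕 T₁)) ⊔
  maxList (map (λ t₂ → minList (map (λ t₁ → d t₁ t₂) (𝓕 T₁))) (𝓕 T₂))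

module Triplet {n : ℕ} where

  -- T|X = Y|(X∖Y) for a triplet X and 2-subset Y ⊆ X:
  -- some cluster meets X exactly in Y
  cherry : Clusters n → Subset n → Subset n → Bool
  cherry H X Y = any (λ C → (C ∈ᶜ H) ∧ ((C ∩ X) == Y)) (subsets n)

  resolved : Clusters n → Subset n → Bool
  resolved H X = any (cherry H X) (pairsOf X)

  sameRestriction : Clusters n → Clusters n → Subset n → Bool
  sameRestriction H₁ H₂ X = any (λ Y → cherry H₁ X Y ∧ cherry H₂ X Y) (pairsOf X)

  #D : Clusters n → Clusters n → ℕ
  #D H₁ H₂ = countSubsets (λ X → ofSize 3 X ∧ resolved H₁ X ∧ resolved H₂ X
                                  ∧ not (sameRestriction H₁ H₂ X))

  #R₁ : Clusters n → Clusters n → ℕ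
  #R₁ H₁ H₂ = countSubsets (λ X → ofSize 3 X ∧ resolved H₁ X ∧ not (resolved H₂ X))

  #R₂ : Clusters n → Clusters n → ℕ
  #R₂ H₁ H₂ = #R₁ H₂ H₁

  d : Clusters n → Clusters n → ℕ
  d = #D

  dHaus : Clusters n → Clusters n → ℕ
  dHaus = dHausWith d

-- An unrooted phylogeny on Fin (suc n) is encoded by
-- the rooted phylogeny on the remaining taxa obtained by rooting it at
-- taxon zero (the root is the neighbour of leaf zero and is deleted
-- together with it; cluster C ⊆ Fin n ↔ edge split (0∉) C | rest).
-- Internal-node degrees = number of children + 1, internal edges and
-- contractions correspond to non-root non-leaf clusters, so
-- isHierarchy / refines / isFullyResolved / 𝓕 have the same meaning.

module Quartet {n : ℕ} where

  lift : Subset n → Subset (suc n)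
  lift C = false ∷ C

  -- T|Q = Y | (Q∖Y): some edge split S | X∖S has S ∩ Q = Y or Q∖Y
  split : Clusters n → Subset (suc n) → Subset (suc n) → Bool
  split H Q Y = any (λ C → (C ∈ᶜ H) ∧
                   (((lift C ∩ Q) == Y) ∨ ((lift C ∩ Q) == (Q ∩ ∁ Y)))) (subsets n)

  resolved : Clusters n → Subset (suc n) → Bool
  resolved H Q = any (split H Q) (pairsOf Q)

  sameRestriction : Clusters n → Clusters n → Subset (suc n) → Bool
  sameRestriction H₁ H₂ Q = any (λ Y → split H₁ Q Y ∧ split H₂ Q Y) (pairsOf Q)

  #D : Clusters n → Clusters n → ℕ
  #D H₁ H₂ = countSubsets (λ Q → ofSize 4 Q ∧ resolved H₁ Q ∧ resolved H₂ Q
                                  ∧ not (sameRestriction H₁ H₂ Q))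

  #R₁ : Clusters n → Clusters n → ℕ
  #R₁ H₁ H₂ = countSubsets (λ Q → ofSize 4 Q ∧ resolved H₁ Q ∧ not (resolved H₂ Q))

  #R₂ : Clusters n → Clusters n → ℕ
  #R₂ H₁ H₂ = #R₁ H₂ H₁

  d : Clusters n → Clusters n → ℕ
  d = #D

  dHaus : Clusters n → Clusters n → ℕ
  dHaus = dHausWith d

{-# OPTIONS --safe #-}
-- A unit U (a triplet, or a quartet with the root taxon 0 removed) is resolved in a hierarchy iff
-- some cluster meets it in exactly two taxa, and all such cuts induce the same split of U.
-- Refine T₁ one polytomy C at a time, adding a cluster C ∖ a for a child a of C. A still unresolved
-- unit of 𝓡₂(T₁, T₂) gets resolved by C ∖ a exactly when C contains three of its taxa and a one of
-- them; so either no child or exactly three children do so, resolving it pairwise differently, and at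
-- most one of these agrees with T₂. Averaging over a keeps 2·(resolved units of 𝓡₂) ≤ 3·(those
-- resolved against T₂). The final fully resolved t₁ ⊇ T₁ resolves all of 𝓡₂ and keeps every
-- disagreement of 𝓓, so d(t₁, t₂) ≥ |𝓓| + ⅔|𝓡₂| for all fully resolved t₂ refining T₂; with the
-- symmetric bound for 𝓡₁ this bounds the Hausdorff distance.
module Submission where

open import Defs
open import Data.Bool using (Bool; true; false; _∧_; _∨_; not; T)
import Data.Bool as Bool
open import Data.Bool.Properties using (T?; T-∧; T-∨; T-≡; T-not-≡; ∧-identityʳ)
open import Data.Bool.ListAction using (all; any; and)
open import Data.Empty using (⊥-elim)
open import Data.Fin using (Fin; zero; suc)
open import Data.Fin.Patterns using (0F; 1F; 2F; 3F)
open import Data.Fin.Subset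
  using (Subset; _∩_; _∪_; ∁; ⊥; ⊤; ⁅_⁆; ∣_∣; _⊆_; ⋃; Nonempty) renaming (_∈_ to _∈ₛ_; _∉_ to _∉ₛ_)
open import Data.Fin.Subset.Properties
  using (⊆-refl; ⊆-trans; ⊆-antisym; p∩q⊆p; p∩q⊆q; x∈p∩q⁺; x∈p∩q⁻; p⊆q⇒∣p∣≤∣q∣; ∣p∩q∣≤∣p∣; ∣⊥∣≡0; ∣⊤∣≡n;
         ∩-comm; ∩-idem; ∩-identityˡ; x∈⁅x⁆; x∈⁅y⁆⇒x≡y; ∣⁅x⁆∣≡1; p⊆p∪q; q⊆p∪q; x∈p∪q⁻; ∉⊥; x∈∁p⇒x∉p; x∉p⇒x∈∁p)
open import Data.List using (List; []; _∷_; map; _++_; filter; length; foldr; allFin)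
open import Data.List.Membership.Propositional using (_∈_; find)
open import Data.List.Membership.Propositional.Properties
  using (∈-++⁺ˡ; ∈-++⁺ʳ; ∈-map⁺; ∈-map⁻; ∈-filter⁺; ∈-filter⁻; ∈-allFin)
open import Data.List.Properties using (map-cong; map-++; map-∘)
open import Data.List.Relation.Unary.All using (All; []; _∷_)
import Data.List.Relation.Unary.All as All
open import Data.List.Relation.Unary.All.Properties using (all⁺; all⁻; ¬All⇒Any¬)
open import Data.List.Relation.Unary.AllPairs using (AllPairs; []; _∷_)
open import Data.List.Relation.Unary.Any using (Any; here; there; satisfied)
import Data.List.Relation.Unary.Any as Any
open import Data.List.Relation.Unary.Any.Properties using (any⁺; any⁻)
open import Data.List.Relation.Unary.Unique.Propositional using (Unique)
import Data.List.Relation.Unary.Unique.Propositional.Properties as Unique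
open import Data.Nat using (ℕ; zero; suc; _+_; _*_; _≤_; _<_; _≥_; z≤n; s≤s; _⊔_; _⊓_; _≡ᵇ_; _≤ᵇ_)
open import Data.Nat.ListAction using (sum)
open import Data.Nat.ListAction.Properties using (sum-++)
open import Data.Nat.Properties
open import Algebra.Properties.CommutativeSemigroup +-commutativeSemigroup using (interchange)
open import Data.Product using (∃; ∃₂; _×_; _,_; proj₁; proj₂)
open import Data.Sum using (_⊎_; inj₁; inj₂; [_,_]′)
import Data.Sum as Sum
open import Data.Vec using (Vec; []; _∷_; lookup; head; tail)
import Data.Vec as Vec
open import Data.Vec.Base using (_[_]=_)
open import Data.Vec.Properties using (∷-injective; ∷-injectiveʳ; ≡-dec; lookup-map)
open import Function using (_∘_; _⇔_; mk⇔; Equivalence; flip; case_of_)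
import Function.Properties.Equivalence as ⇔
open import Relation.Binary.PropositionalEquality
open import Relation.Nullary using (¬_; Dec; yes; no)
open import Relation.Nullary.Decidable using (isYes; toWitness; fromWitness)

open Equivalence using (to; from)

T-⇔⇒≡ : {a b : Bool} → (T a ⇔ T b) → a ≡ b
T-⇔⇒≡ {true}  {true}  _ = refl
T-⇔⇒≡ {true}  {false} e = ⊥-elim (to e _)
T-⇔⇒≡ {false} {true}  e = ⊥-elim (from e _)
T-⇔⇒≡ {false} {false} _ = refl

⇔-same⇒≡ : {a b : Bool} {P : Set} → T a ⇔ P → T b ⇔ P → a ≡ b
⇔-same⇒≡ a⇔P b⇔P = T-⇔⇒≡ (⇔.trans a⇔P (⇔.sym b⇔P))

T-not : {a : Bool} → T (not a) ⇔ (¬ T a)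
T-not {true}  = mk⇔ (λ ()) (λ f → f _)
T-not {false} = mk⇔ (λ _ ()) (λ _ → _)

T⇒≡true : {a : Bool} → T a → a ≡ true
T⇒≡true = to T-≡

¬T⇒≡false : {a : Bool} → ¬ T a → a ≡ false
¬T⇒≡false = to T-not-≡ ∘ from T-not

¬T⇒∧≡∧ : {a : Bool} (x y : Bool) → ¬ T a → a ∧ x ≡ a ∧ y
¬T⇒∧≡∧ {true}  _ _ ¬a = ⊥-elim (¬a _)
¬T⇒∧≡∧ {false} _ _ _  = refl

𝟙 : Bool → ℕ
𝟙 true  = 1
𝟙 false = 0

𝟙-true : {a : Bool} → T a → 𝟙 a ≡ 1
𝟙-true {true} _ = refl

𝟙-false : {a : Bool} → ¬ T a → 𝟙 a ≡ 0
𝟙-false {true}  ¬a = ⊥-elim (¬a _)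
𝟙-false {false} _  = refl

𝟙-exclusive-≤ : {a b c : Bool} → (T a → ¬ T b) → (T a → T c) → (T b → T c) → 𝟙 a + 𝟙 b ≤ 𝟙 c
𝟙-exclusive-≤ {true}  {true}          excl _   _   = ⊥-elim (excl _ _)
𝟙-exclusive-≤ {true}  {false} {true}  _    _   _   = ≤-refl
𝟙-exclusive-≤ {true}  {false} {false} _    a⇒c _   = ⊥-elim (a⇒c _)
𝟙-exclusive-≤ {false} {true}  {true}  _    _   _   = ≤-refl
𝟙-exclusive-≤ {false} {true}  {false} _    _   b⇒c = ⊥-elim (b⇒c _)
𝟙-exclusive-≤ {false} {false}         _    _   _   = z≤n

module _ {A : Set} where

  ∑ : List A → (A → ℕ) → ℕ
  ∑ xs g = sum (map g xs)

  ∑-cong : (xs : List A) {g h : A → ℕ} → (∀ x → x ∈ xs → g x ≡ h x) → ∑ xs g ≡ ∑ xs h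
  ∑-cong []       _ = refl
  ∑-cong (x ∷ xs) e = cong₂ _+_ (e x (here refl)) (∑-cong xs (λ y y∈ → e y (there y∈)))

  ∑-mono : (xs : List A) {g h : A → ℕ} → (∀ x → x ∈ xs → g x ≤ h x) → ∑ xs g ≤ ∑ xs h
  ∑-mono []       _ = z≤n
  ∑-mono (x ∷ xs) p = +-mono-≤ (p x (here refl)) (∑-mono xs (λ y y∈ → p y (there y∈)))

  ∑-mono-< : (xs : List A) {g h : A → ℕ} → (∀ x → x ∈ xs → g x ≤ h x) →
             ∀ {y} → y ∈ xs → g y < h y → ∑ xs g < ∑ xs h
  ∑-mono-< (x ∷ xs) le (here refl) lt = +-mono-<-≤ lt (∑-mono xs (λ z z∈ → le z (there z∈)))
  ∑-mono-< (x ∷ xs) le (there y∈)  lt =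
    +-mono-≤-< (le x (here refl)) (∑-mono-< xs (λ z z∈ → le z (there z∈)) y∈ lt)

  ∑-zero : (xs : List A) {g : A → ℕ} → (∀ x → x ∈ xs → g x ≡ 0) → ∑ xs g ≡ 0
  ∑-zero []       _ = refl
  ∑-zero (x ∷ xs) z = cong₂ _+_ (z x (here refl)) (∑-zero xs (λ y y∈ → z y (there y∈)))

  ∑-+ : (xs : List A) (g h : A → ℕ) → ∑ xs (λ x → g x + h x) ≡ ∑ xs g + ∑ xs h
  ∑-+ []       g h = refl
  ∑-+ (x ∷ xs) g h = trans (cong ((g x + h x) +_) (∑-+ xs g h)) (interchange (g x) (h x) (∑ xs g) (∑ xs h))

  ∑-* : (xs : List A) (k : ℕ) (g : A → ℕ) → ∑ xs (λ x → k * g x) ≡ k * ∑ xs g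
  ∑-* []       k g = sym (*-zeroʳ k)
  ∑-* (x ∷ xs) k g = trans (cong (k * g x +_) (∑-* xs k g)) (sym (*-distribˡ-+ k (g x) (∑ xs g)))

  ∑-++ : (xs ys : List A) (g : A → ℕ) → ∑ (xs ++ ys) g ≡ ∑ xs g + ∑ ys g
  ∑-++ xs ys g = trans (cong sum (map-++ g xs ys)) (sum-++ (map g xs) (map g ys))

  ≤∑ : (xs : List A) (g : A → ℕ) {x : A} → x ∈ xs → g x ≤ ∑ xs g
  ≤∑ (y ∷ xs) g (here refl) = m≤m+n (g y) _
  ≤∑ (y ∷ xs) g (there x∈)  = ≤-trans (≤∑ xs g x∈) (m≤n+m _ (g y))

  length-filter≡∑𝟙 : (p : A → Bool) (xs : List A) → length (filter (T? ∘ p) xs) ≡ ∑ xs (𝟙 ∘ p)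
  length-filter≡∑𝟙 p []       = refl
  length-filter≡∑𝟙 p (x ∷ xs) with p x
  ... | true  = cong suc (length-filter≡∑𝟙 p xs)
  ... | false = length-filter≡∑𝟙 p xs

  ∑-≤⇒∃-≤ : (xs : List A) (g h : A → ℕ) → ∑ xs h ≤ ∑ xs g → (∃ λ x → x ∈ xs) →
            ∃ λ x → x ∈ xs × h x ≤ g x
  ∑-≤⇒∃-≤ (x ∷ xs) g h le _ with h x ≤? g x
  ... | yes hx≤gx = x , here refl , hx≤gx
  ... | no  hx≰gx with xs
  ...   | [] = ⊥-elim (hx≰gx (subst₂ _≤_ (+-identityʳ (h x)) (+-identityʳ (g x)) le))
  ...   | y ∷ ys with ∑-≤⇒∃-≤ (y ∷ ys) g h
                       (+-cancelˡ-≤ (g x) _ _ (≤-trans (+-monoˡ-≤ _ (≰⇒≥ hx≰gx)) le)) (y , here refl)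
  ...     | z , z∈ , hz≤gz = z , there z∈ , hz≤gz

  ∑𝟙≤1 : (xs : List A) → AllPairs _≢_ xs → (p : A → Bool) →
         (∀ {a b} → a ∈ xs → b ∈ xs → a ≢ b → T (p a) → ¬ T (p b)) → ∑ xs (𝟙 ∘ p) ≤ 1
  ∑𝟙≤1 []       _               p _    = z≤n
  ∑𝟙≤1 (x ∷ xs) (x∉xs AllPairs.∷ uniq) p excl with T? (p x)
  ... | yes px = ≤-reflexive (cong₂ _+_ (𝟙-true px) (∑-zero xs others-false))
    where
    others-false : ∀ y → y ∈ xs → 𝟙 (p y) ≡ 0
    others-false y y∈ = 𝟙-false (excl (here refl) (there y∈) (All.lookup x∉xs y∈) px)
  ... | no ¬px = subst (_≤ 1) (cong (_+ ∑ xs (𝟙 ∘ p)) (sym (𝟙-false ¬px)))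
                       (∑𝟙≤1 xs uniq p (λ a∈ b∈ → excl (there a∈) (there b∈)))

module _ {A B : Set} where

  ∑-swap : (xs : List A) (ys : List B) (g : A → B → ℕ) →
           ∑ xs (λ x → ∑ ys (g x)) ≡ ∑ ys (λ y → ∑ xs (λ x → g x y))
  ∑-swap []       ys g = sym (∑-zero ys (λ _ _ → refl))
  ∑-swap (x ∷ xs) ys g = trans (cong (∑ ys (g x) +_) (∑-swap xs ys g))
                               (sym (∑-+ ys (g x) (λ y → ∑ xs (λ x → g x y))))

  ∑-map : (xs : List A) (f : A → B) (g : B → ℕ) → ∑ (map f xs) g ≡ ∑ xs (g ∘ f)
  ∑-map xs f g = cong sum (sym (map-∘ xs))

≤-maxList : {A : Set} (f : A → ℕ) {xs : List A} {x : A} → x ∈ xs → f x ≤ maxList (map f xs)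
≤-maxList f {y ∷ _} (here refl) = m≤m⊔n (f y) _
≤-maxList f {y ∷ _} (there x∈)  = ≤-trans (≤-maxList f x∈) (m≤n⊔m (f y) _)

minList-attained : {A : Set} (f : A → ℕ) {xs : List A} {x : A} → x ∈ xs →
                   ∃ λ y → y ∈ xs × minList (map f xs) ≡ f y
minList-attained f {x ∷ xs} _ with attained (f x) xs
  where
  attained : ∀ z ys → foldr _⊓_ z (map f ys) ≡ z ⊎ ∃ λ y → y ∈ ys × foldr _⊓_ z (map f ys) ≡ f y
  attained z []       = inj₁ refl
  attained z (y ∷ ys) with ⊓-sel (f y) (foldr _⊓_ z (map f ys))
  ... | inj₁ e = inj₂ (y , here refl , e)
  ... | inj₂ e with attained z ys
  ...   | inj₁ e′ = inj₁ (trans e e′)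
  ...   | inj₂ (w , w∈ , e′) = inj₂ (w , there w∈ , trans e e′)
... | inj₁ e = x , here refl , e
... | inj₂ (w , w∈ , e) = w , there w∈ , e

∈-subsets : ∀ {n} (A : Subset n) → A ∈ subsets n
∈-subsets []               = here refl
∈-subsets {suc n} (false ∷ A) = ∈-++⁺ˡ (∈-map⁺ (false ∷_) (∈-subsets A))
∈-subsets {suc n} (true ∷ A)  = ∈-++⁺ʳ (map (false ∷_) (subsets n)) (∈-map⁺ (true ∷_) (∈-subsets A))

subsets-unique : ∀ n → Unique (subsets n)
subsets-unique zero    = All.[] AllPairs.∷ AllPairs.[]
subsets-unique (suc n) =
  Unique.++⁺ (Unique.map⁺ ∷-injectiveʳ (subsets-unique n)) (Unique.map⁺ ∷-injectiveʳ (subsets-unique n)) disjoint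
  where
  disjoint : ∀ {v} → ¬ (v ∈ map (false ∷_) (subsets n) × v ∈ map (true ∷_) (subsets n))
  disjoint (v∈ₗ , v∈ᵣ) with ∈-map⁻ (false ∷_) v∈ₗ | ∈-map⁻ (true ∷_) v∈ᵣ
  ... | _ , _ , refl | _ , _ , ()

filter∈sublists : {A : Set} (p : A → Bool) (xs : List A) → filter (T? ∘ p) xs ∈ sublists xs
filter∈sublists p []       = here refl
filter∈sublists p (x ∷ xs) with p x
... | true  = ∈-++⁺ʳ (sublists xs) (∈-map⁺ (x ∷_) (filter∈sublists p xs))
... | false = ∈-++⁺ˡ (filter∈sublists p xs)

∈∧∈∧≢⇒2≤length : {A : Set} {L : List A} {a b : A} → a ∈ L → b ∈ L → a ≢ b → 2 ≤ length L
∈∧∈∧≢⇒2≤length (here refl) (here refl) a≢b = ⊥-elim (a≢b refl)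
∈∧∈∧≢⇒2≤length (here refl) (there (here _)) _ = s≤s (s≤s z≤n)
∈∧∈∧≢⇒2≤length (here refl) (there (there _)) _ = s≤s (s≤s z≤n)
∈∧∈∧≢⇒2≤length (there (here _)) (here refl) _ = s≤s (s≤s z≤n)
∈∧∈∧≢⇒2≤length (there (there _)) (here refl) _ = s≤s (s≤s z≤n)
∈∧∈∧≢⇒2≤length (there a∈) (there b∈) a≢b = m≤n⇒m≤1+n (∈∧∈∧≢⇒2≤length a∈ b∈ a≢b)

two-others : {A : Set} (xs : List A) → AllPairs _≢_ xs → 3 ≤ length xs → {a : A} → a ∈ xs →
             (∀ (x y : A) → Dec (x ≡ y)) →
             ∃₂ λ b c → b ∈ xs × c ∈ xs × b ≢ a × c ≢ a × b ≢ c
two-others []          _ ()                 _ _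
two-others (_ ∷ [])     _ (s≤s ())           _ _
two-others (_ ∷ _ ∷ []) _ (s≤s (s≤s ()))     _ _
two-others (x₁ ∷ x₂ ∷ x₃ ∷ _) ((x₁≢x₂ ∷ x₁≢x₃ ∷ _) ∷ (x₂≢x₃ ∷ _) ∷ _) _ {a} _ _≟_ with a ≟ x₁ | a ≟ x₂
... | yes refl | _        = x₂ , x₃ , there (here refl) , there (there (here refl)) , x₁≢x₂ ∘ sym , x₁≢x₃ ∘ sym , x₂≢x₃
... | no a≢x₁  | yes refl = x₁ , x₃ , here refl , there (there (here refl)) , x₁≢x₂ , x₂≢x₃ ∘ sym , x₁≢x₃
... | no a≢x₁  | no a≢x₂  = x₁ , x₂ , here refl , there (here refl) , a≢x₁ ∘ sym , a≢x₂ ∘ sym , x₁≢x₂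

module _ {n : ℕ} where

  T-anySubset : {p : Subset n → Bool} → T (any p (subsets n)) ⇔ ∃ (T ∘ p)
  T-anySubset {p} = mk⇔ (satisfied ∘ any⁻ p (subsets n))
                        (λ (A , pA) → any⁺ p (Any.map (λ { refl → pA }) (∈-subsets A)))

  T-allSubsets : {p : Subset n → Bool} → T (all p (subsets n)) ⇔ (∀ A → T (p A))
  T-allSubsets {p} = mk⇔ (λ h A → All.lookup (all⁺ p (subsets n) h) (∈-subsets A))
                         (λ h → all⁻ p {xs = subsets n} (All.tabulate (λ {A} _ → h A)))

  ¬T-allSubsets : {p : Subset n → Bool} → ¬ T (all p (subsets n)) → ∃ λ A → ¬ T (p A)
  ¬T-allSubsets {p} h = satisfied (¬All⇒Any¬ (T? ∘ p) (subsets n) (h ∘ all⁻ p))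

countSubsets-cong : ∀ {n} {p q : Subset n → Bool} → (∀ A → p A ≡ q A) → countSubsets p ≡ countSubsets q
countSubsets-cong {n} {p} {q} p≗q =
  trans (length-filter≡∑𝟙 p (subsets n))
        (trans (∑-cong (subsets n) (λ A _ → cong 𝟙 (p≗q A))) (sym (length-filter≡∑𝟙 q (subsets n))))

countSubsets-suc : ∀ {n} (p : Subset (suc n) → Bool) →
                   countSubsets p ≡ ∑ (subsets n) (λ A → 𝟙 (p (false ∷ A)) + 𝟙 (p (true ∷ A)))
countSubsets-suc {n} p = begin
  countSubsets p
    ≡⟨ length-filter≡∑𝟙 p (subsets (suc n)) ⟩
  ∑ (map (false ∷_) (subsets n) ++ map (true ∷_) (subsets n)) (𝟙 ∘ p)
    ≡⟨ ∑-++ (map (false ∷_) (subsets n)) _ (𝟙 ∘ p) ⟩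
  ∑ (map (false ∷_) (subsets n)) (𝟙 ∘ p) + ∑ (map (true ∷_) (subsets n)) (𝟙 ∘ p)
    ≡⟨ cong₂ _+_ (∑-map (subsets n) (false ∷_) (𝟙 ∘ p)) (∑-map (subsets n) (true ∷_) (𝟙 ∘ p)) ⟩
  ∑ (subsets n) (λ A → 𝟙 (p (false ∷ A))) + ∑ (subsets n) (λ A → 𝟙 (p (true ∷ A)))
    ≡⟨ ∑-+ (subsets n) _ _ ⟨
  ∑ (subsets n) (λ A → 𝟙 (p (false ∷ A)) + 𝟙 (p (true ∷ A)))
    ∎
  where open ≡-Reasoning

infixr 8 _∩ᶠ_
infixr 7 _∪ᶠ_
data Formula (k : ℕ) : Set where
  var       : Fin k → Formula k
  _∩ᶠ_ _∪ᶠ_ : Formula k → Formula k → Formula k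
  ∁ᶠ        : Formula k → Formula k
  ⊥ᶠ        : Formula k

module _ {k : ℕ} where

  ⟦_⟧ᵇ : Formula k → Vec Bool k → Bool
  ⟦ var i  ⟧ᵇ ρ = lookup ρ i
  ⟦ e ∩ᶠ f ⟧ᵇ ρ = ⟦ e ⟧ᵇ ρ ∧ ⟦ f ⟧ᵇ ρ
  ⟦ e ∪ᶠ f ⟧ᵇ ρ = ⟦ e ⟧ᵇ ρ ∨ ⟦ f ⟧ᵇ ρ
  ⟦ ∁ᶠ e   ⟧ᵇ ρ = not (⟦ e ⟧ᵇ ρ)
  ⟦ ⊥ᶠ     ⟧ᵇ ρ = false

  ⟦_⟧ : ∀ {m} → Formula k → Vec (Subset m) k → Subset m
  ⟦ var i  ⟧ σ = lookup σ i
  ⟦ e ∩ᶠ f ⟧ σ = ⟦ e ⟧ σ ∩ ⟦ f ⟧ σ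
  ⟦ e ∪ᶠ f ⟧ σ = ⟦ e ⟧ σ ∪ ⟦ f ⟧ σ
  ⟦ ∁ᶠ e   ⟧ σ = ∁ (⟦ e ⟧ σ)
  ⟦ ⊥ᶠ     ⟧ σ = ⊥

  infix 6 _≐_
  record Equation : Set where
    constructor _≐_
    field lhs rhs : Formula k

  Holds : ∀ {m} → Vec (Subset m) k → Equation → Set
  Holds σ (l ≐ r) = ⟦ l ⟧ σ ≡ ⟦ r ⟧ σ

  holdsᵇ : Vec Bool k → Equation → Bool
  holdsᵇ ρ (l ≐ r) = isYes (⟦ l ⟧ᵇ ρ Bool.≟ ⟦ r ⟧ᵇ ρ)

  -- Subset k is Vec Bool k, so subsets k enumerates all Boolean assignments
  Tautology : List Equation → Equation → Bool
  Tautology hyps concl = all (λ ρ → not (all (holdsᵇ ρ) hyps) ∨ holdsᵇ ρ concl) (subsets k)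

  private
    ⟦⟧-∷ : ∀ {m} (e : Formula k) (σ : Vec (Subset (suc m)) k) →
           ⟦ e ⟧ σ ≡ ⟦ e ⟧ᵇ (Vec.map head σ) ∷ ⟦ e ⟧ (Vec.map tail σ)
    ⟦⟧-∷ (var i) σ rewrite lookup-map i head σ | lookup-map i tail σ with lookup σ i
    ... | _ ∷ _ = refl
    ⟦⟧-∷ (e ∩ᶠ f) σ rewrite ⟦⟧-∷ e σ | ⟦⟧-∷ f σ = refl
    ⟦⟧-∷ (e ∪ᶠ f) σ rewrite ⟦⟧-∷ e σ | ⟦⟧-∷ f σ = refl
    ⟦⟧-∷ (∁ᶠ e)   σ rewrite ⟦⟧-∷ e σ = refl
    ⟦⟧-∷ ⊥ᶠ       σ = refl

    Holds-∷ : ∀ {m} (σ : Vec (Subset (suc m)) k) (eq : Equation) →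
              Holds σ eq ⇔ (T (holdsᵇ (Vec.map head σ) eq) × Holds (Vec.map tail σ) eq)
    Holds-∷ σ (l ≐ r) rewrite ⟦⟧-∷ l σ | ⟦⟧-∷ r σ =
      mk⇔ (λ e → fromWitness (proj₁ (∷-injective e)) , proj₂ (∷-injective e))
          (λ (hd , tl) → cong₂ _∷_ (toWitness hd) tl)

  tautology-lift : (hyps : List Equation) (concl : Equation) → T (Tautology hyps concl) →
                   ∀ {m} (σ : Vec (Subset m) k) → All (Holds σ) hyps → Holds σ concl
  tautology-lift hyps (l ≐ r) taut {zero} σ _ with ⟦ l ⟧ σ | ⟦ r ⟧ σ
  ... | [] | [] = refl
  tautology-lift hyps concl taut {suc m} σ hs =
    from (Holds-∷ σ concl)
      ( [ (λ ¬hyps → ⊥-elim (to T-not ¬hyps (all⁻ _ (heads hs)))) , (λ c → c) ]′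
          (to T-∨ (to T-allSubsets taut (Vec.map head σ)))
      , tautology-lift hyps concl taut (Vec.map tail σ) (tails hs))
    where
    heads : ∀ {eqs} → All (Holds σ) eqs → All (T ∘ holdsᵇ (Vec.map head σ)) eqs
    heads []       = []
    heads {eq ∷ _} (h ∷ hs) = proj₁ (to (Holds-∷ σ eq) h) ∷ heads hs
    tails : ∀ {eqs} → All (Holds σ) eqs → All (Holds (Vec.map tail σ)) eqs
    tails []       = []
    tails {eq ∷ _} (h ∷ hs) = proj₂ (to (Holds-∷ σ eq) h) ∷ tails hs

  identity : (eq : Equation) → T (Tautology [] eq) → ∀ {m} (σ : Vec (Subset m) k) → Holds σ eq
  identity eq taut σ = tautology-lift [] eq taut σ []

x₀ : ∀ {k} → Formula (suc k)
x₀ = var 0F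
x₁ : ∀ {k} → Formula (suc (suc k))
x₁ = var 1F
x₂ : ∀ {k} → Formula (suc (suc (suc k)))
x₂ = var 2F
x₃ : ∀ {k} → Formula (suc (suc (suc (suc k))))
x₃ = var 3F

module _ {n : ℕ} where

  T-== : {A B : Subset n} → T (A == B) ⇔ A ≡ B
  T-== = mk⇔ toWitness fromWitness

  ⊆⇔∩≡ : {A B : Subset n} → A ⊆ B ⇔ A ∩ B ≡ A
  ⊆⇔∩≡ {A} {B} = mk⇔ (λ A⊆B → ⊆-antisym (p∩q⊆p A B) (λ x∈A → x∈p∩q⁺ (x∈A , A⊆B x∈A)))
                     (λ e {x} x∈A → proj₂ (x∈p∩q⁻ A B (subst (x ∈ₛ_) (sym e) x∈A)))

  T-⊆ᵇ : {A B : Subset n} → T (A ⊆ᵇ B) ⇔ A ⊆ B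
  T-⊆ᵇ = mk⇔ (from ⊆⇔∩≡ ∘ to T-==) (from T-== ∘ to ⊆⇔∩≡)

  infix 4 _⊊_
  _⊊_ : Subset n → Subset n → Set
  A ⊊ B = A ⊆ B × A ≢ B

  T-⊂ᵇ : {A B : Subset n} → T (A ⊂ᵇ B) ⇔ A ⊊ B
  T-⊂ᵇ {A} {B} = mk⇔ ⇒ ⇐
    where
    ⇒ : T (A ⊂ᵇ B) → A ⊊ B
    ⇒ h = to T-⊆ᵇ (proj₁ (to T-∧ h)) , to T-not (proj₂ (to T-∧ h)) ∘ from T-==
    ⇐ : A ⊊ B → T (A ⊂ᵇ B)
    ⇐ (A⊆B , A≢B) = from T-∧ (from T-⊆ᵇ A⊆B , from T-not (A≢B ∘ to T-==))

∣p∣≡∣p∩q∣+∣p∩∁q∣ : ∀ {n} (p q : Subset n) → ∣ p ∣ ≡ ∣ p ∩ q ∣ + ∣ p ∩ ∁ q ∣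
∣p∣≡∣p∩q∣+∣p∩∁q∣ []         []          = refl
∣p∣≡∣p∩q∣+∣p∩∁q∣ (true ∷ p)  (true ∷ q)  = cong suc (∣p∣≡∣p∩q∣+∣p∩∁q∣ p q)
∣p∣≡∣p∩q∣+∣p∩∁q∣ (true ∷ p)  (false ∷ q) = trans (cong suc (∣p∣≡∣p∩q∣+∣p∩∁q∣ p q)) (sym (+-suc _ _))
∣p∣≡∣p∩q∣+∣p∩∁q∣ (false ∷ p) (_ ∷ q)     = ∣p∣≡∣p∩q∣+∣p∩∁q∣ p q

∣p∣+∣q∣≡∣p∪q∣+∣p∩q∣ : ∀ {n} (p q : Subset n) → ∣ p ∣ + ∣ q ∣ ≡ ∣ p ∪ q ∣ + ∣ p ∩ q ∣
∣p∣+∣q∣≡∣p∪q∣+∣p∩q∣ []          []          = refl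
∣p∣+∣q∣≡∣p∪q∣+∣p∩q∣ (true ∷ p)  (true ∷ q)  =
  cong suc (trans (+-suc ∣ p ∣ ∣ q ∣) (trans (cong suc (∣p∣+∣q∣≡∣p∪q∣+∣p∩q∣ p q)) (sym (+-suc _ _))))
∣p∣+∣q∣≡∣p∪q∣+∣p∩q∣ (true ∷ p)  (false ∷ q) = cong suc (∣p∣+∣q∣≡∣p∪q∣+∣p∩q∣ p q)
∣p∣+∣q∣≡∣p∪q∣+∣p∩q∣ (false ∷ p) (true ∷ q)  = trans (+-suc ∣ p ∣ ∣ q ∣) (cong suc (∣p∣+∣q∣≡∣p∪q∣+∣p∩q∣ p q))
∣p∣+∣q∣≡∣p∪q∣+∣p∩q∣ (false ∷ p) (false ∷ q) = ∣p∣+∣q∣≡∣p∪q∣+∣p∩q∣ p q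

∣p∪q∣≡∣p∣+∣q∣ : ∀ {n} (p q : Subset n) → p ∩ q ≡ ⊥ → ∣ p ∪ q ∣ ≡ ∣ p ∣ + ∣ q ∣
∣p∪q∣≡∣p∣+∣q∣ {n} p q disj = sym (begin
  ∣ p ∣ + ∣ q ∣         ≡⟨ ∣p∣+∣q∣≡∣p∪q∣+∣p∩q∣ p q ⟩
  ∣ p ∪ q ∣ + ∣ p ∩ q ∣ ≡⟨ cong (λ r → ∣ p ∪ q ∣ + ∣ r ∣) disj ⟩
  ∣ p ∪ q ∣ + ∣ ⊥ {n} ∣ ≡⟨ cong (∣ p ∪ q ∣ +_) (∣⊥∣≡0 n) ⟩
  ∣ p ∪ q ∣ + 0         ≡⟨ +-identityʳ _ ⟩
  ∣ p ∪ q ∣             ∎)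
  where open ≡-Reasoning

∣p∣≡0⇒p≡⊥ : ∀ {n} (p : Subset n) → ∣ p ∣ ≡ 0 → p ≡ ⊥
∣p∣≡0⇒p≡⊥ []          _ = refl
∣p∣≡0⇒p≡⊥ (false ∷ p) e = cong (false ∷_) (∣p∣≡0⇒p≡⊥ p e)

0<∣p∣⇒nonempty : ∀ {n} (p : Subset n) → 0 < ∣ p ∣ → Nonempty p
0<∣p∣⇒nonempty (true ∷ p)  _ = zero , _[_]=_.here
0<∣p∣⇒nonempty (false ∷ p) h with 0<∣p∣⇒nonempty p h
... | x , x∈p = suc x , _[_]=_.there x∈p

∣X∣≡∣Y∣+∣X∖Y∣ : ∀ {n} {X Y : Subset n} → Y ⊆ X → ∣ X ∣ ≡ ∣ Y ∣ + ∣ X ∩ ∁ Y ∣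
∣X∣≡∣Y∣+∣X∖Y∣ {X = X} {Y} Y⊆X =
  trans (∣p∣≡∣p∩q∣+∣p∩∁q∣ X Y) (cong (λ Z → ∣ Z ∣ + ∣ X ∩ ∁ Y ∣) (trans (∩-comm X Y) (to ⊆⇔∩≡ Y⊆X)))

module _ {n : ℕ} {p q : Subset n} where

  ⊆∧∣∣≡⇒≡ : p ⊆ q → ∣ p ∣ ≡ ∣ q ∣ → p ≡ q
  ⊆∧∣∣≡⇒≡ p⊆q ∣p∣≡∣q∣ =
    tautology-lift (x₀ ∩ᶠ x₁ ≐ x₀ ∷ x₁ ∩ᶠ ∁ᶠ x₀ ≐ ⊥ᶠ ∷ []) (x₀ ≐ x₁) _ (p ∷ q ∷ []) (p∩q≡p ∷ q∖p≡⊥ ∷ [])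
    where
    p∩q≡p : p ∩ q ≡ p
    p∩q≡p = to ⊆⇔∩≡ p⊆q
    q∖p≡⊥ : q ∩ ∁ p ≡ ⊥
    q∖p≡⊥ = ∣p∣≡0⇒p≡⊥ (q ∩ ∁ p)
              (+-cancelˡ-≡ ∣ p ∣ _ _ (trans (sym (∣X∣≡∣Y∣+∣X∖Y∣ p⊆q)) (trans (sym ∣p∣≡∣q∣) (sym (+-identityʳ _)))))

  ⊊⇒∣∣< : p ⊊ q → ∣ p ∣ < ∣ q ∣
  ⊊⇒∣∣< p⊊q = ≤∧≢⇒< (p⊆q⇒∣p∣≤∣q∣ (proj₁ p⊊q)) (proj₂ p⊊q ∘ ⊆∧∣∣≡⇒≡ (proj₁ p⊊q))

  ⊊⇒∃∉ : p ⊊ q → ∃ λ x → x ∈ₛ q × x ∉ₛ p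
  ⊊⇒∃∉ p⊊q with 0<∣p∣⇒nonempty (q ∩ ∁ p) 0<∣q∖p∣
    where
    0<∣q∖p∣ : 0 < ∣ q ∩ ∁ p ∣
    0<∣q∖p∣ = +-cancelˡ-< ∣ p ∣ _ _ (begin-strict
      ∣ p ∣ + 0           ≡⟨ +-identityʳ _ ⟩
      ∣ p ∣               <⟨ ⊊⇒∣∣< p⊊q ⟩
      ∣ q ∣               ≡⟨ ∣X∣≡∣Y∣+∣X∖Y∣ (proj₁ p⊊q) ⟩
      ∣ p ∣ + ∣ q ∩ ∁ p ∣ ∎)
      where open ≤-Reasoning
  ... | x , x∈q∖p = x , proj₁ (x∈p∩q⁻ q (∁ p) x∈q∖p) , x∈∁p⇒x∉p (proj₂ (x∈p∩q⁻ q (∁ p) x∈q∖p))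

∩-monoˡ-⊆ : ∀ {n} {A B : Subset n} (U : Subset n) → A ⊆ B → A ∩ U ⊆ B ∩ U
∩-monoˡ-⊆ {A = A} U A⊆B x∈ = let (x∈A , x∈U) = x∈p∩q⁻ A U x∈ in x∈p∩q⁺ (A⊆B x∈A , x∈U)

∣C∖a∩U∣+∣a∩U∣≡∣C∩U∣ : ∀ {n} {a C : Subset n} (U : Subset n) → a ⊆ C →
                       ∣ (C ∩ ∁ a) ∩ U ∣ + ∣ a ∩ U ∣ ≡ ∣ C ∩ U ∣
∣C∖a∩U∣+∣a∩U∣≡∣C∩U∣ {a = a} {C} U a⊆C = begin
  ∣ (C ∩ ∁ a) ∩ U ∣ + ∣ a ∩ U ∣          ≡⟨ +-comm _ ∣ a ∩ U ∣ ⟩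
  ∣ a ∩ U ∣ + ∣ (C ∩ ∁ a) ∩ U ∣          ≡⟨ cong₂ (λ p q → ∣ p ∣ + ∣ q ∣) a∩U C∖a∩U ⟨
  ∣ (C ∩ U) ∩ a ∣ + ∣ (C ∩ U) ∩ ∁ a ∣    ≡⟨ ∣p∣≡∣p∩q∣+∣p∩∁q∣ (C ∩ U) a ⟨
  ∣ C ∩ U ∣                              ∎
  where
  open ≡-Reasoning
  a∩U : (C ∩ U) ∩ a ≡ a ∩ U
  a∩U = tautology-lift (x₂ ∩ᶠ x₀ ≐ x₂ ∷ []) ((x₀ ∩ᶠ x₁) ∩ᶠ x₂ ≐ x₂ ∩ᶠ x₁) _ (C ∷ U ∷ a ∷ []) (to ⊆⇔∩≡ a⊆C ∷ [])
  C∖a∩U : (C ∩ U) ∩ ∁ a ≡ (C ∩ ∁ a) ∩ U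
  C∖a∩U = identity ((x₀ ∩ᶠ x₁) ∩ᶠ ∁ᶠ x₂ ≐ (x₀ ∩ᶠ ∁ᶠ x₂) ∩ᶠ x₁) _ (C ∷ U ∷ a ∷ [])

module _ {n : ℕ} where

  T-∈ᶜ : {C : Subset n} {H : Clusters n} → T (C ∈ᶜ H) ⇔ C ∈ H
  T-∈ᶜ {C} {H} = mk⇔ (Any.map (to T-==) ∘ any⁻ (C ==_) H) (any⁺ (C ==_) ∘ Any.map (from T-==))

  T-refines : {H′ H : Clusters n} → T (refines H′ H) ⇔ (∀ {C} → C ∈ H → C ∈ H′)
  T-refines {H′} {H} = mk⇔ ⇒ ⇐
    where
    ⇒ : T (refines H′ H) → ∀ {C} → C ∈ H → C ∈ H′
    ⇒ r {C} C∈H with to (T-∨ {not (C ∈ᶜ H)}) (to T-allSubsets r C)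
    ... | inj₁ C∉H  = ⊥-elim (to T-not C∉H (from T-∈ᶜ C∈H))
    ... | inj₂ C∈H′ = to T-∈ᶜ C∈H′
    ⇐ : (∀ {C} → C ∈ H → C ∈ H′) → T (refines H′ H)
    ⇐ H⊆H′ = from T-allSubsets λ C → case T? (C ∈ᶜ H) of λ
      { (yes C∈H) → from (T-∨ {not (C ∈ᶜ H)}) (inj₂ (from T-∈ᶜ (H⊆H′ (to T-∈ᶜ C∈H))))
      ; (no  C∉H) → from (T-∨ {not (C ∈ᶜ H)}) (inj₁ (from T-not C∉H)) }

  Laminar : Subset n → Subset n → Set
  Laminar A B = A ⊆ B ⊎ B ⊆ A ⊎ A ∩ B ≡ ⊥

  Laminar-sym : {A B : Subset n} → Laminar A B → Laminar B A
  Laminar-sym (inj₁ A⊆B)               = inj₂ (inj₁ A⊆B)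
  Laminar-sym (inj₂ (inj₁ B⊆A))        = inj₁ B⊆A
  Laminar-sym {A} {B} (inj₂ (inj₂ A∩B≡⊥)) = inj₂ (inj₂ (trans (∩-comm B A) A∩B≡⊥))

  T-laminar : {A B : Subset n} → T ((A ⊆ᵇ B) ∨ (B ⊆ᵇ A) ∨ disjointᵇ A B) ⇔ Laminar A B
  T-laminar {A} {B} = mk⇔ ⇒ ⇐
    where
    ⇒ : T ((A ⊆ᵇ B) ∨ (B ⊆ᵇ A) ∨ disjointᵇ A B) → Laminar A B
    ⇒ h with to (T-∨ {A ⊆ᵇ B}) h
    ... | inj₁ A⊆B = inj₁ (to T-⊆ᵇ A⊆B)
    ... | inj₂ h′ with to (T-∨ {B ⊆ᵇ A}) h′
    ...   | inj₁ B⊆A = inj₂ (inj₁ (to T-⊆ᵇ B⊆A))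
    ...   | inj₂ disj = inj₂ (inj₂ (to T-== disj))
    ⇐ : Laminar A B → T ((A ⊆ᵇ B) ∨ (B ⊆ᵇ A) ∨ disjointᵇ A B)
    ⇐ (inj₁ A⊆B)         = from (T-∨ {A ⊆ᵇ B}) (inj₁ (from T-⊆ᵇ A⊆B))
    ⇐ (inj₂ (inj₁ B⊆A))  = from (T-∨ {A ⊆ᵇ B}) (inj₂ (from (T-∨ {B ⊆ᵇ A}) (inj₁ (from T-⊆ᵇ B⊆A))))
    ⇐ (inj₂ (inj₂ disj)) = from (T-∨ {A ⊆ᵇ B}) (inj₂ (from (T-∨ {B ⊆ᵇ A}) (inj₂ (from T-== disj))))

  record IsHierarchy (H : Clusters n) : Set where
    field
      ⊤∈ : ⊤ ∈ H
      ⁅⁆∈ : ∀ i → ⁅ i ⁆ ∈ H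
      ⊥∉ : ¬ ⊥ ∈ H
      laminar : ∀ {A B} → A ∈ H → B ∈ H → Laminar A B

  open IsHierarchy public

  T-isHierarchy : {H : Clusters n} → T (isHierarchy H) ⇔ IsHierarchy H
  T-isHierarchy {H} = mk⇔ ⇒ ⇐
    where
    laminarᵇ : Subset n → Subset n → Bool
    laminarᵇ A B = (A ⊆ᵇ B) ∨ (B ⊆ᵇ A) ∨ disjointᵇ A B
    singletonsᵇ : Bool
    singletonsᵇ = all (λ i → ⁅ i ⁆ ∈ᶜ H) (allFin n)
    ⇒ : T (isHierarchy H) → IsHierarchy H
    ⇒ h =
      let (⊤∈H , h′) = to (T-∧ {⊤ ∈ᶜ H}) h
          (singletons , h″) = to (T-∧ {singletonsᵇ}) h′
          (⊥∉H , lam) = to (T-∧ {not (⊥ ∈ᶜ H)}) h″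
      in record
        { ⊤∈ = to T-∈ᶜ ⊤∈H
        ; ⁅⁆∈ = λ i → to T-∈ᶜ (All.lookup (all⁺ (λ i → ⁅ i ⁆ ∈ᶜ H) (allFin n) singletons) (∈-allFin i))
        ; ⊥∉ = to T-not ⊥∉H ∘ from T-∈ᶜ
        ; laminar = λ {A} {B} A∈H B∈H → to T-laminar
            (All.lookup (all⁺ (laminarᵇ A) H (All.lookup (all⁺ (λ A → all (laminarᵇ A) H) H lam) A∈H)) B∈H) }
    ⇐ : IsHierarchy H → T (isHierarchy H)
    ⇐ hH = from (T-∧ {⊤ ∈ᶜ H}) (from T-∈ᶜ (⊤∈ hH) , from (T-∧ {singletonsᵇ})
             (singletons , from (T-∧ {not (⊥ ∈ᶜ H)}) (from T-not (⊥∉ hH ∘ to T-∈ᶜ) , lam)))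
      where
      singletons : T singletonsᵇ
      singletons = all⁻ (λ i → ⁅ i ⁆ ∈ᶜ H) {xs = allFin n} (All.tabulate (λ {i} _ → from T-∈ᶜ (⁅⁆∈ hH i)))
      lam : T (all (λ A → all (laminarᵇ A) H) H)
      lam = all⁻ (λ A → all (laminarᵇ A) H) {xs = H} (All.tabulate (λ {A} A∈H → all⁻ (laminarᵇ A) {xs = H}
              (All.tabulate (λ {B} B∈H → from (T-laminar {A} {B}) (laminar hH A∈H B∈H)))))

  IsHierarchy-resp : {H H′ : Clusters n} → (∀ {C} → C ∈ H ⇔ C ∈ H′) → IsHierarchy H → IsHierarchy H′
  IsHierarchy-resp H≈H′ hH = record
    { ⊤∈ = to H≈H′ (⊤∈ hH)
    ; ⁅⁆∈ = λ i → to H≈H′ (⁅⁆∈ hH i)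
    ; ⊥∉ = ⊥∉ hH ∘ from H≈H′
    ; laminar = λ A∈ B∈ → laminar hH (from H≈H′ A∈) (from H≈H′ B∈) }

  record IsChild (H : Clusters n) (C D : Subset n) : Set where
    field
      member  : D ∈ H
      proper  : D ⊊ C
      maximal : ∀ {E} → E ∈ H → D ⊊ E → ¬ E ⊊ C

  open IsChild public

  private
    strictlyBetween : Clusters n → Subset n → Subset n → Subset n → Bool
    strictlyBetween H C D E = (E ∈ᶜ H) ∧ (D ⊂ᵇ E) ∧ (E ⊂ᵇ C)

    T-strictlyBetween : {H : Clusters n} {C D E : Subset n} →
                        T (strictlyBetween H C D E) ⇔ (E ∈ H × D ⊊ E × E ⊊ C)
    T-strictlyBetween {H} {C} {D} {E} = mk⇔
      (λ h → let (E∈H , h′) = to (T-∧ {E ∈ᶜ H}) h ; (D⊂E , E⊂C) = to (T-∧ {D ⊂ᵇ E}) h′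
             in to T-∈ᶜ E∈H , to T-⊂ᵇ D⊂E , to T-⊂ᵇ E⊂C)
      (λ (E∈H , D⊊E , E⊊C) → from (T-∧ {E ∈ᶜ H}) (from T-∈ᶜ E∈H , from (T-∧ {D ⊂ᵇ E}) (from T-⊂ᵇ D⊊E , from T-⊂ᵇ E⊊C)))

  T-isChild : {H : Clusters n} {C D : Subset n} → T (isChild H C D) ⇔ IsChild H C D
  T-isChild {H} {C} {D} = mk⇔ ⇒ ⇐
    where
    ⇒ : T (isChild H C D) → IsChild H C D
    ⇒ h = record
      { member = to T-∈ᶜ (proj₁ (to (T-∧ {D ∈ᶜ H}) h))
      ; proper = to T-⊂ᵇ (proj₁ (to (T-∧ {D ⊂ᵇ C}) rest))
      ; maximal = λ {E} E∈H D⊊E E⊊C →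
          to T-not (proj₂ (to (T-∧ {D ⊂ᵇ C}) rest)) (from (T-anySubset {p = strictlyBetween H C D}) (E , from T-strictlyBetween (E∈H , D⊊E , E⊊C))) }
      where
      rest : T ((D ⊂ᵇ C) ∧ not (any (strictlyBetween H C D) (subsets n)))
      rest = proj₂ (to (T-∧ {D ∈ᶜ H}) h)
    ⇐ : IsChild H C D → T (isChild H C D)
    ⇐ c = from (T-∧ {D ∈ᶜ H}) (from T-∈ᶜ (member c) , from (T-∧ {D ⊂ᵇ C}) (from T-⊂ᵇ (proper c) , from T-not noneBetween))
      where
      noneBetween : ¬ T (any (strictlyBetween H C D) (subsets n))
      noneBetween h = let (E , b) = to (T-anySubset {p = strictlyBetween H C D}) h ; (E∈H , D⊊E , E⊊C) = to (T-strictlyBetween {H} {C} {D}) b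
                      in maximal c E∈H D⊊E E⊊C

  ¬child⇒strictlyBetween : {H : Clusters n} {C D : Subset n} → D ∈ H → D ⊊ C → ¬ T (isChild H C D) →
                           ∃ λ E → E ∈ H × D ⊊ E × E ⊊ C
  ¬child⇒strictlyBetween {H} {C} {D} D∈H D⊊C ¬child with T? (any (strictlyBetween H C D) (subsets n))
  ... | yes h = let (E , b) = to (T-anySubset {p = strictlyBetween H C D}) h in E , to (T-strictlyBetween {H} {C} {D}) b
  ... | no ¬h = ⊥-elim (¬child (from (T-∧ {D ∈ᶜ H}) (from T-∈ᶜ D∈H , from (T-∧ {D ⊂ᵇ C}) (from T-⊂ᵇ D⊊C , from T-not ¬h))))

  children : Clusters n → Subset n → List (Subset n)
  children H C = filter (T? ∘ isChild H C) (subsets n)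

  ∈-children⇔ : {H : Clusters n} {C D : Subset n} → D ∈ children H C ⇔ IsChild H C D
  ∈-children⇔ {H} {C} {D} =
    mk⇔ (to T-isChild ∘ proj₂ ∘ ∈-filter⁻ (T? ∘ isChild H C) {xs = subsets n})
        (∈-filter⁺ (T? ∘ isChild H C) (∈-subsets D) ∘ from T-isChild)

  children-unique : (H : Clusters n) (C : Subset n) → Unique (children H C)
  children-unique H C = Unique.filter⁺ (T? ∘ isChild H C) (subsets-unique n)

  ⊊⇒⊆child : {H : Clusters n} {C E : Subset n} → E ∈ H → E ⊊ C → ∃ λ a → a ∈ children H C × E ⊆ a
  ⊊⇒⊆child {H} {C} {E} = climb (∣ C ∣) E (m≤n+m ∣ C ∣ ∣ E ∣)
    where
    climb : (k : ℕ) (E : Subset n) → ∣ C ∣ ≤ ∣ E ∣ + k → E ∈ H → E ⊊ C → ∃ λ a → a ∈ children H C × E ⊆ a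
    climb k E bound E∈H E⊊C with T? (isChild H C E)
    ... | yes child = E , from (∈-children⇔ {H} {C}) (to (T-isChild {H} {C}) child) , ⊆-refl
    ... | no ¬child with ¬child⇒strictlyBetween E∈H E⊊C ¬child
    ...   | F , F∈H , E⊊F , F⊊C with k
    ...     | zero = ⊥-elim (<⇒≱ (⊊⇒∣∣< E⊊C) (subst (∣ C ∣ ≤_) (+-identityʳ _) bound))
    ...     | suc k′ with climb k′ F (≤-trans bound (≤-trans (≤-reflexive (+-suc ∣ E ∣ k′)) (+-monoˡ-≤ k′ (⊊⇒∣∣< E⊊F)))) F∈H F⊊C
    ...       | a , a∈ , F⊆a = a , a∈ , ⊆-trans (proj₁ E⊊F) F⊆a

  children-disjoint : {H : Clusters n} {C a b : Subset n} → IsHierarchy H →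
                      a ∈ children H C → b ∈ children H C → a ≢ b → a ∩ b ≡ ⊥
  children-disjoint {H} {C} hH a∈ b∈ a≢b with to (∈-children⇔ {H} {C}) a∈ | to (∈-children⇔ {H} {C}) b∈
  ... | ca | cb with laminar hH (member ca) (member cb)
  ... | inj₁ a⊆b        = ⊥-elim (maximal ca (member cb) (a⊆b , a≢b) (proper cb))
  ... | inj₂ (inj₁ b⊆a) = ⊥-elim (maximal cb (member ca) (b⊆a , a≢b ∘ sym) (proper ca))
  ... | inj₂ (inj₂ a∩b≡⊥) = a∩b≡⊥

  ∈⇒0<∣∣ : {H : Clusters n} → IsHierarchy H → {D : Subset n} → D ∈ H → 0 < ∣ D ∣
  ∈⇒0<∣∣ hH {D} D∈H with ∣ D ∣ in ∣D∣≡
  ... | zero  = ⊥-elim (⊥∉ hH (subst (_∈ _) (∣p∣≡0⇒p≡⊥ D ∣D∣≡) D∈H))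
  ... | suc _ = s≤s z≤n

  disjoint-⋃ : {a : Subset n} (L : List (Subset n)) → (∀ {b} → b ∈ L → a ∩ b ≡ ⊥) → a ∩ ⋃ L ≡ ⊥
  disjoint-⋃ {a} []      _    = identity (x₀ ∩ᶠ ⊥ᶠ ≐ ⊥ᶠ) _ (a ∷ [])
  disjoint-⋃ {a} (b ∷ L) disj =
    tautology-lift (x₀ ∩ᶠ x₁ ≐ ⊥ᶠ ∷ x₀ ∩ᶠ x₂ ≐ ⊥ᶠ ∷ []) (x₀ ∩ᶠ (x₁ ∪ᶠ x₂) ≐ ⊥ᶠ) _ (a ∷ b ∷ ⋃ L ∷ [])
      (disj (here refl) All.∷ disjoint-⋃ L (disj ∘ there) All.∷ All.[])

  ∑∣∩∣≡∣⋃∩∣ : (L : List (Subset n)) → AllPairs _≢_ L → (∀ {a b} → a ∈ L → b ∈ L → a ≢ b → a ∩ b ≡ ⊥) →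
              (U : Subset n) → ∑ L (λ a → ∣ a ∩ U ∣) ≡ ∣ ⋃ L ∩ U ∣
  ∑∣∩∣≡∣⋃∩∣ []      _              _    U = sym (trans (cong ∣_∣ (identity (⊥ᶠ ∩ᶠ x₀ ≐ ⊥ᶠ) _ (U ∷ []))) (∣⊥∣≡0 n))
  ∑∣∩∣≡∣⋃∩∣ (a ∷ L) (a∉L ∷ uniq) disj U = begin
    ∣ a ∩ U ∣ + ∑ L (λ b → ∣ b ∩ U ∣) ≡⟨ cong (∣ a ∩ U ∣ +_) (∑∣∩∣≡∣⋃∩∣ L uniq (λ a∈ b∈ → disj (there a∈) (there b∈)) U) ⟩
    ∣ a ∩ U ∣ + ∣ ⋃ L ∩ U ∣            ≡⟨ ∣p∪q∣≡∣p∣+∣q∣ (a ∩ U) (⋃ L ∩ U) a∩U∩⋃L∩U≡⊥ ⟨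
    ∣ (a ∩ U) ∪ (⋃ L ∩ U) ∣            ≡⟨ cong ∣_∣ (identity ((x₀ ∩ᶠ x₂) ∪ᶠ (x₁ ∩ᶠ x₂) ≐ (x₀ ∪ᶠ x₁) ∩ᶠ x₂) _ (a ∷ ⋃ L ∷ U ∷ [])) ⟩
    ∣ (a ∪ ⋃ L) ∩ U ∣                  ∎
    where
    open ≡-Reasoning
    a∩⋃L≡⊥ : a ∩ ⋃ L ≡ ⊥
    a∩⋃L≡⊥ = disjoint-⋃ L (λ b∈ → disj (here refl) (there b∈) (All.lookup a∉L b∈))
    a∩U∩⋃L∩U≡⊥ : (a ∩ U) ∩ (⋃ L ∩ U) ≡ ⊥
    a∩U∩⋃L∩U≡⊥ = tautology-lift (x₀ ∩ᶠ x₁ ≐ ⊥ᶠ ∷ []) ((x₀ ∩ᶠ x₂) ∩ᶠ (x₁ ∩ᶠ x₂) ≐ ⊥ᶠ) _ (a ∷ ⋃ L ∷ U ∷ [])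
                   (a∩⋃L≡⊥ All.∷ All.[])

  module Node {H : Clusters n} (hH : IsHierarchy H) {C : Subset n} (C∈H : C ∈ H) (2≤∣C∣ : 2 ≤ ∣ C ∣) where

    child⊆ : {a : Subset n} → a ∈ children H C → a ⊆ C
    child⊆ a∈ = proj₁ (proper (to (∈-children⇔ {H} {C}) a∈))

    children-cover : {x : Fin n} → x ∈ₛ C → ∃ λ a → a ∈ children H C × x ∈ₛ a
    children-cover {x} x∈C with ⊊⇒⊆child (⁅⁆∈ hH x) (⁅x⁆⊆C , ⁅x⁆≢C)
      where
      ⁅x⁆⊆C : ⁅ x ⁆ ⊆ C
      ⁅x⁆⊆C y∈⁅x⁆ = subst (_∈ₛ C) (sym (x∈⁅y⁆⇒x≡y x y∈⁅x⁆)) x∈C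
      ⁅x⁆≢C : ⁅ x ⁆ ≢ C
      ⁅x⁆≢C e = <⇒≢ (subst (_< ∣ C ∣) (sym (∣⁅x⁆∣≡1 x)) 2≤∣C∣) (cong ∣_∣ e)
    ... | a , a∈ , ⁅x⁆⊆a = a , a∈ , ⁅x⁆⊆a (x∈⁅x⁆ x)

    ⋃children≡C : ⋃ (children H C) ≡ C
    ⋃children≡C = ⊆-antisym ⋃⊆C C⊆⋃
      where
      ⋃⊆C : ⋃ (children H C) ⊆ C
      ⋃⊆C {x} = go (children H C) (λ a∈ → a∈)
        where
        go : (L : List (Subset n)) → (∀ {a} → a ∈ L → a ∈ children H C) → x ∈ₛ ⋃ L → x ∈ₛ C
        go []      _   x∈ = ⊥-elim (∉⊥ x∈)
        go (a ∷ L) sub x∈ with x∈p∪q⁻ a (⋃ L) x∈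
        ... | inj₁ x∈a = child⊆ (sub (here refl)) x∈a
        ... | inj₂ x∈⋃ = go L (sub ∘ there) x∈⋃
      C⊆⋃ : C ⊆ ⋃ (children H C)
      C⊆⋃ x∈C = let (a , a∈ , x∈a) = children-cover x∈C in go a∈ x∈a
        where
        go : ∀ {L a x} → a ∈ L → x ∈ₛ a → x ∈ₛ ⋃ L
        go {b ∷ L} (here refl) x∈a = p⊆p∪q (⋃ L) x∈a
        go {b ∷ L} (there a∈)  x∈a = q⊆p∪q b (⋃ L) (go a∈ x∈a)

    ∑children : (U : Subset n) → ∑ (children H C) (λ a → ∣ a ∩ U ∣) ≡ ∣ C ∩ U ∣
    ∑children U = trans (∑∣∩∣≡∣⋃∩∣ (children H C) (children-unique H C) (children-disjoint hH) U)
                        (cong (λ D → ∣ D ∩ U ∣) ⋃children≡C)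

    2≤#children : 2 ≤ length (children H C)
    2≤#children with 0<∣p∣⇒nonempty C (≤-trans (s≤s z≤n) 2≤∣C∣)
    ... | x , x∈C with children-cover x∈C
    ... | a , a∈ , _ with ⊊⇒∃∉ (proper (to (∈-children⇔ {H} {C}) a∈))
    ... | z , z∈C , z∉a with children-cover z∈C
    ... | b , b∈ , z∈b = ∈∧∈∧≢⇒2≤length a∈ b∈ (λ a≡b → z∉a (subst (z ∈ₛ_) (sym a≡b) z∈b))

  ≡true⇒IsHierarchy : (H : Clusters n) → isHierarchy H ≡ true → IsHierarchy H
  ≡true⇒IsHierarchy H h = to (T-isHierarchy {H}) (subst T (sym h) _)

module _ {n : ℕ} where

  IsUnit : Subset n → Set
  IsUnit U = ∣ U ∣ ≡ 3 ⊎ ∣ U ∣ ≡ 4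

  IsUnit⇒3≤∣∣ : {U : Subset n} → IsUnit U → 3 ≤ ∣ U ∣
  IsUnit⇒3≤∣∣ = [ ≤-reflexive ∘ sym , (λ ∣U∣≡4 → ≤-trans (n≤1+n 3) (≤-reflexive (sym ∣U∣≡4))) ]′

  cutsᵇ : Subset n → Subset n → Bool
  cutsᵇ K U = ∣ K ∩ U ∣ ≡ᵇ 2

  T-cutsᵇ : (K U : Subset n) → T (cutsᵇ K U) ⇔ ∣ K ∩ U ∣ ≡ 2
  T-cutsᵇ K U = mk⇔ (≡ᵇ⇒≡ ∣ K ∩ U ∣ 2) (≡⇒≡ᵇ ∣ K ∩ U ∣ 2)

  -- H|U is fully resolved iff some cluster meets U in exactly two taxa
  resolvesᵇ : Clusters n → Subset n → Bool
  resolvesᵇ H U = any (λ K → (K ∈ᶜ H) ∧ cutsᵇ K U) (subsets n)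

  Resolves : Clusters n → Subset n → Set
  Resolves H U = ∃ λ K → K ∈ H × ∣ K ∩ U ∣ ≡ 2

  T-resolvesᵇ : (H : Clusters n) (U : Subset n) → T (resolvesᵇ H U) ⇔ Resolves H U
  T-resolvesᵇ H U = mk⇔
    (λ h → let (K , t) = to (T-anySubset {p = λ K → (K ∈ᶜ H) ∧ cutsᵇ K U}) h ; (K∈H , cut) = to (T-∧ {K ∈ᶜ H}) t
           in K , to T-∈ᶜ K∈H , to (T-cutsᵇ K U) cut)
    (λ (K , K∈H , cut) → from (T-anySubset {p = λ K → (K ∈ᶜ H) ∧ cutsᵇ K U})
                           (K , from (T-∧ {K ∈ᶜ H}) (from T-∈ᶜ K∈H , from (T-cutsᵇ K U) cut)))

  Resolves-mono : {H H′ : Clusters n} {U : Subset n} → (∀ {C} → C ∈ H → C ∈ H′) → Resolves H U → Resolves H′ U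
  Resolves-mono H⊆H′ (K , K∈H , cut) = K , H⊆H′ K∈H , cut

  resolvesᵇ-∷ : (K : Subset n) (H : Clusters n) (U : Subset n) → resolvesᵇ (K ∷ H) U ≡ cutsᵇ K U ∨ resolvesᵇ H U
  resolvesᵇ-∷ K H U = T-⇔⇒≡ (mk⇔ ⇒ ⇐)
    where
    ⇒ : T (resolvesᵇ (K ∷ H) U) → T (cutsᵇ K U ∨ resolvesᵇ H U)
    ⇒ h with to (T-resolvesᵇ (K ∷ H) U) h
    ... | K′ , here refl , cut = from (T-∨ {cutsᵇ K U}) (inj₁ (from (T-cutsᵇ K U) cut))
    ... | K′ , there K′∈H , cut = from (T-∨ {cutsᵇ K U}) (inj₂ (from (T-resolvesᵇ H U) (K′ , K′∈H , cut)))
    ⇐ : T (cutsᵇ K U ∨ resolvesᵇ H U) → T (resolvesᵇ (K ∷ H) U)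
    ⇐ h with to (T-∨ {cutsᵇ K U}) h
    ... | inj₁ cut = from (T-resolvesᵇ (K ∷ H) U) (K , here refl , to (T-cutsᵇ K U) cut)
    ... | inj₂ r   = from (T-resolvesᵇ (K ∷ H) U) (Resolves-mono there (to (T-resolvesᵇ H U) r))

  SameSplit : Subset n → Subset n → Subset n → Set
  SameSplit U K B = K ∩ U ≡ B ∩ U ⊎ K ∩ U ≡ U ∩ ∁ B

  sameSplitᵇ : Subset n → Subset n → Subset n → Bool
  sameSplitᵇ U K B = ((K ∩ U) == (B ∩ U)) ∨ ((K ∩ U) == (U ∩ ∁ B))

  T-sameSplitᵇ : (U K B : Subset n) → T (sameSplitᵇ U K B) ⇔ SameSplit U K B
  T-sameSplitᵇ U K B = mk⇔
    (Sum.map (to T-==) (to T-==) ∘ to (T-∨ {(K ∩ U) == (B ∩ U)}))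
    (from (T-∨ {(K ∩ U) == (B ∩ U)}) ∘ Sum.map (from T-==) (from T-==))

  SameSplit-sym : {U K B : Subset n} → SameSplit U K B → SameSplit U B K
  SameSplit-sym (inj₁ e) = inj₁ (sym e)
  SameSplit-sym {U} {K} {B} (inj₂ e) =
    inj₂ (tautology-lift (x₀ ∩ᶠ x₂ ≐ x₂ ∩ᶠ ∁ᶠ x₁ ∷ []) (x₁ ∩ᶠ x₂ ≐ x₂ ∩ᶠ ∁ᶠ x₀) _ (K ∷ B ∷ U ∷ []) (e ∷ []))

  SameSplit-trans : {U X Y Z : Subset n} → SameSplit U X Y → SameSplit U Y Z → SameSplit U X Z
  SameSplit-trans (inj₁ e₁) (inj₁ e₂) = inj₁ (trans e₁ e₂)
  SameSplit-trans (inj₁ e₁) (inj₂ e₂) = inj₂ (trans e₁ e₂)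
  SameSplit-trans {U} {X} {Y} {Z} (inj₂ e₁) (inj₁ e₂) =
    inj₂ (tautology-lift (x₀ ∩ᶠ x₃ ≐ x₃ ∩ᶠ ∁ᶠ x₁ ∷ x₁ ∩ᶠ x₃ ≐ x₂ ∩ᶠ x₃ ∷ []) (x₀ ∩ᶠ x₃ ≐ x₃ ∩ᶠ ∁ᶠ x₂) _
                         (X ∷ Y ∷ Z ∷ U ∷ []) (e₁ ∷ e₂ ∷ []))
  SameSplit-trans {U} {X} {Y} {Z} (inj₂ e₁) (inj₂ e₂) =
    inj₁ (tautology-lift (x₀ ∩ᶠ x₃ ≐ x₃ ∩ᶠ ∁ᶠ x₁ ∷ x₁ ∩ᶠ x₃ ≐ x₃ ∩ᶠ ∁ᶠ x₂ ∷ []) (x₀ ∩ᶠ x₃ ≐ x₂ ∩ᶠ x₃) _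
                         (X ∷ Y ∷ Z ∷ U ∷ []) (e₁ ∷ e₂ ∷ []))

  disjoint-cuts⇒complementary : {U K K′ : Subset n} → IsUnit U → K ∩ K′ ≡ ⊥ →
                                ∣ K ∩ U ∣ ≡ 2 → ∣ K′ ∩ U ∣ ≡ 2 → K ∩ U ≡ U ∩ ∁ K′
  disjoint-cuts⇒complementary {U} {K} {K′} unit K∩K′≡⊥ cut cut′ =
    tautology-lift (x₀ ∩ᶠ x₁ ≐ ⊥ᶠ ∷ (x₀ ∪ᶠ x₁) ∩ᶠ x₂ ≐ x₂ ∷ []) (x₀ ∩ᶠ x₂ ≐ x₂ ∩ᶠ ∁ᶠ x₁) _
                   (K ∷ K′ ∷ U ∷ []) (K∩K′≡⊥ ∷ K∪K′⊇U ∷ [])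
    where
    ∣K∪K′∩U∣≡4 : ∣ (K ∪ K′) ∩ U ∣ ≡ 4
    ∣K∪K′∩U∣≡4 = begin
      ∣ (K ∪ K′) ∩ U ∣          ≡⟨ cong ∣_∣ (identity ((x₀ ∪ᶠ x₁) ∩ᶠ x₂ ≐ (x₀ ∩ᶠ x₂) ∪ᶠ (x₁ ∩ᶠ x₂)) _ (K ∷ K′ ∷ U ∷ [])) ⟩
      ∣ (K ∩ U) ∪ (K′ ∩ U) ∣    ≡⟨ ∣p∪q∣≡∣p∣+∣q∣ (K ∩ U) (K′ ∩ U) disjoint ⟩
      ∣ K ∩ U ∣ + ∣ K′ ∩ U ∣    ≡⟨ cong₂ _+_ cut cut′ ⟩
      4                         ∎
      where
      open ≡-Reasoning
      disjoint : (K ∩ U) ∩ (K′ ∩ U) ≡ ⊥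
      disjoint = tautology-lift (x₀ ∩ᶠ x₁ ≐ ⊥ᶠ ∷ []) ((x₀ ∩ᶠ x₂) ∩ᶠ (x₁ ∩ᶠ x₂) ≐ ⊥ᶠ) _ (K ∷ K′ ∷ U ∷ []) (K∩K′≡⊥ ∷ [])
    ∣U∣≡4 : ∣ U ∣ ≡ 4
    ∣U∣≡4 = [ ∣U∣≢3 , (λ ∣U∣≡4 → ∣U∣≡4) ]′ unit
      where
      ∣U∣≢3 : ∣ U ∣ ≡ 3 → ∣ U ∣ ≡ 4
      ∣U∣≢3 ∣U∣≡3 = ⊥-elim (<⇒≱ (s≤s (s≤s (s≤s (s≤s z≤n))))
                       (subst₂ _≤_ ∣K∪K′∩U∣≡4 ∣U∣≡3 (p⊆q⇒∣p∣≤∣q∣ (p∩q⊆q (K ∪ K′) U))))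
    K∪K′⊇U : (K ∪ K′) ∩ U ≡ U
    K∪K′⊇U = ⊆∧∣∣≡⇒≡ (p∩q⊆q (K ∪ K′) U) (trans ∣K∪K′∩U∣≡4 (sym ∣U∣≡4))

  cut-unique : {H : Clusters n} → IsHierarchy H → {U K K′ : Subset n} → IsUnit U →
               K ∈ H → K′ ∈ H → ∣ K ∩ U ∣ ≡ 2 → ∣ K′ ∩ U ∣ ≡ 2 → SameSplit U K K′
  cut-unique hH {U} unit K∈H K′∈H cut cut′ with laminar hH K∈H K′∈H
  ... | inj₁ K⊆K′          = inj₁ (⊆∧∣∣≡⇒≡ (∩-monoˡ-⊆ U K⊆K′) (trans cut (sym cut′)))
  ... | inj₂ (inj₁ K′⊆K)   = inj₁ (sym (⊆∧∣∣≡⇒≡ (∩-monoˡ-⊆ U K′⊆K) (trans cut′ (sym cut))))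
  ... | inj₂ (inj₂ K∩K′≡⊥) = inj₂ (disjoint-cuts⇒complementary unit K∩K′≡⊥ cut cut′)

  matchedᵇ : Clusters n → Subset n → Subset n → Bool
  matchedᵇ G U K = any (λ B → (B ∈ᶜ G) ∧ cutsᵇ B U ∧ sameSplitᵇ U K B) (subsets n)

  Matched : Clusters n → Subset n → Subset n → Set
  Matched G U K = ∃ λ B → B ∈ G × ∣ B ∩ U ∣ ≡ 2 × SameSplit U K B

  T-matchedᵇ : (G : Clusters n) (U K : Subset n) → T (matchedᵇ G U K) ⇔ Matched G U K
  T-matchedᵇ G U K = mk⇔
    (λ h → let (B , t) = to (T-anySubset {p = λ B → (B ∈ᶜ G) ∧ cutsᵇ B U ∧ sameSplitᵇ U K B}) h
               (B∈G , t′) = to (T-∧ {B ∈ᶜ G}) t ; (cut , same) = to (T-∧ {cutsᵇ B U}) t′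
           in B , to T-∈ᶜ B∈G , to (T-cutsᵇ B U) cut , to (T-sameSplitᵇ U K B) same)
    (λ (B , B∈G , cut , same) → from (T-anySubset {p = λ B → (B ∈ᶜ G) ∧ cutsᵇ B U ∧ sameSplitᵇ U K B})
      (B , from (T-∧ {B ∈ᶜ G}) (from T-∈ᶜ B∈G , from (T-∧ {cutsᵇ B U}) (from (T-cutsᵇ B U) cut , from (T-sameSplitᵇ U K B) same))))

  agreeᵇ : Clusters n → Clusters n → Subset n → Bool
  agreeᵇ H G U = any (λ K → (K ∈ᶜ H) ∧ cutsᵇ K U ∧ matchedᵇ G U K) (subsets n)

  Agree : Clusters n → Clusters n → Subset n → Set
  Agree H G U = ∃ λ K → K ∈ H × ∣ K ∩ U ∣ ≡ 2 × Matched G U K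

  T-agreeᵇ : (H G : Clusters n) (U : Subset n) → T (agreeᵇ H G U) ⇔ Agree H G U
  T-agreeᵇ H G U = mk⇔
    (λ h → let (K , t) = to (T-anySubset {p = λ K → (K ∈ᶜ H) ∧ cutsᵇ K U ∧ matchedᵇ G U K}) h
               (K∈H , t′) = to (T-∧ {K ∈ᶜ H}) t ; (cut , m) = to (T-∧ {cutsᵇ K U}) t′
           in K , to T-∈ᶜ K∈H , to (T-cutsᵇ K U) cut , to (T-matchedᵇ G U K) m)
    (λ (K , K∈H , cut , m) → from (T-anySubset {p = λ K → (K ∈ᶜ H) ∧ cutsᵇ K U ∧ matchedᵇ G U K})
      (K , from (T-∧ {K ∈ᶜ H}) (from T-∈ᶜ K∈H , from (T-∧ {cutsᵇ K U}) (from (T-cutsᵇ K U) cut , from (T-matchedᵇ G U K) m))))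

  Agree-sym : {H G : Clusters n} {U : Subset n} → Agree H G U → Agree G H U
  Agree-sym (K , K∈H , cut , B , B∈G , cut′ , same) = B , B∈G , cut′ , K , K∈H , cut , SameSplit-sym same

  Agree-unique : {H G : Clusters n} → IsHierarchy H → IsHierarchy G → {U K B : Subset n} → IsUnit U →
                 K ∈ H → ∣ K ∩ U ∣ ≡ 2 → B ∈ G → ∣ B ∩ U ∣ ≡ 2 → Agree H G U → SameSplit U K B
  Agree-unique hH hG unit K∈H cut B∈G cut′ (K′ , K′∈H , cutK′ , B′ , B′∈G , cutB′ , same) =
    SameSplit-trans (cut-unique hH unit K∈H K′∈H cut cutK′) (SameSplit-trans same (cut-unique hG unit B′∈G B∈G cutB′ cut′))

  fullyResolved⇒binary : {H : Clusters n} → T (isFullyResolved H) →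
                          {C : Subset n} → C ∈ H → 2 ≤ ∣ C ∣ → length (children H C) ≡ 2
  fullyResolved⇒binary {H} fr {C} C∈H 2≤∣C∣ with to (T-∨ {not (C ∈ᶜ H)}) (to T-allSubsets fr C)
  ... | inj₁ C∉H = ⊥-elim (to T-not C∉H (from T-∈ᶜ C∈H))
  ... | inj₂ h with to (T-∨ {∣ C ∣ ≤ᵇ 1}) h
  ...   | inj₁ ∣C∣≤1 = ⊥-elim (<⇒≱ 2≤∣C∣ (≤ᵇ⇒≤ ∣ C ∣ 1 ∣C∣≤1))
  ...   | inj₂ binary = ≡ᵇ⇒≡ _ 2 binary

  ¬fullyResolved⇒polytomy : {H : Clusters n} → IsHierarchy H → ¬ T (isFullyResolved H) →
                            ∃ λ C → C ∈ H × 2 ≤ ∣ C ∣ × 3 ≤ length (children H C)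
  ¬fullyResolved⇒polytomy {H} hH ¬fr with ¬T-allSubsets ¬fr
  ... | C , ¬ok = C , C∈H , 2≤∣C∣ , ≤∧≢⇒< (Node.2≤#children hH C∈H 2≤∣C∣) (#≢2 ∘ sym)
    where
    C∈H : C ∈ H
    C∈H with T? (C ∈ᶜ H)
    ... | yes C∈ᶜH = to T-∈ᶜ C∈ᶜH
    ... | no  C∉ᶜH = ⊥-elim (¬ok (from (T-∨ {not (C ∈ᶜ H)}) (inj₁ (from T-not C∉ᶜH))))
    2≤∣C∣ : 2 ≤ ∣ C ∣
    2≤∣C∣ with ∣ C ∣ ≤? 1
    ... | yes ∣C∣≤1 = ⊥-elim (¬ok (from (T-∨ {not (C ∈ᶜ H)}) (inj₂ (from (T-∨ {∣ C ∣ ≤ᵇ 1}) (inj₁ (≤⇒≤ᵇ ∣C∣≤1))))))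
    ... | no  ∣C∣≰1 = ≰⇒> ∣C∣≰1
    #≢2 : length (children H C) ≢ 2
    #≢2 #≡2 = ¬ok (from (T-∨ {not (C ∈ᶜ H)}) (inj₂ (from (T-∨ {∣ C ∣ ≤ᵇ 1}) (inj₂ (≡⇒≡ᵇ _ 2 #≡2)))))

  private
    length≡2 : {A : Set} (xs : List A) → length xs ≡ 2 → ∃₂ λ a b → xs ≡ a ∷ b ∷ []
    length≡2 (a ∷ b ∷ []) _ = a , b , refl

    3≤+⇒3≤⊎3≤ : ∀ x y → 3 ≤ x + y → x ≢ 2 → y ≢ 2 → 3 ≤ x ⊎ 3 ≤ y
    3≤+⇒3≤⊎3≤ (suc (suc (suc x))) y _ _ _ = inj₁ (s≤s (s≤s (s≤s z≤n)))
    3≤+⇒3≤⊎3≤ (suc (suc zero)) y _ x≢2 _ = ⊥-elim (x≢2 refl)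
    3≤+⇒3≤⊎3≤ (suc zero) (suc (suc (suc y))) _ _ _ = inj₂ (s≤s (s≤s (s≤s z≤n)))
    3≤+⇒3≤⊎3≤ (suc zero) (suc (suc zero)) _ _ y≢2 = ⊥-elim (y≢2 refl)
    3≤+⇒3≤⊎3≤ (suc zero) (suc zero) (s≤s (s≤s ())) _ _
    3≤+⇒3≤⊎3≤ (suc zero) zero (s≤s ()) _ _
    3≤+⇒3≤⊎3≤ zero y 3≤y _ _ = inj₂ 3≤y

  binary-node : {H : Clusters n} → IsHierarchy H → T (isFullyResolved H) → {C : Subset n} → C ∈ H → 2 ≤ ∣ C ∣ →
                (U : Subset n) → ∃₂ λ a b → IsChild H C a × IsChild H C b × ∣ a ∩ U ∣ + ∣ b ∩ U ∣ ≡ ∣ C ∩ U ∣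
  binary-node {H} hH fr {C} C∈H 2≤∣C∣ U with length≡2 (children H C) (fullyResolved⇒binary fr C∈H 2≤∣C∣)
  ... | a , b , ch≡ab =
    a , b , to ∈-children⇔ (subst (a ∈_) (sym ch≡ab) (here refl)) , to ∈-children⇔ (subst (b ∈_) (sym ch≡ab) (there (here refl))) ,
    (begin
      ∣ a ∩ U ∣ + ∣ b ∩ U ∣                ≡⟨ cong (∣ a ∩ U ∣ +_) (+-identityʳ _) ⟨
      ∑ (a ∷ b ∷ []) (λ d → ∣ d ∩ U ∣)    ≡⟨ cong (λ L → ∑ L (λ d → ∣ d ∩ U ∣)) ch≡ab ⟨
      ∑ (children H C) (λ d → ∣ d ∩ U ∣)  ≡⟨ Node.∑children hH C∈H 2≤∣C∣ U ⟩
      ∣ C ∩ U ∣                            ∎)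
    where open ≡-Reasoning

  -- descend from the root, always into a child still containing three taxa of U
  fullyResolved⇒Resolves : {H : Clusters n} → IsHierarchy H → T (isFullyResolved H) →
                           {U : Subset n} → 3 ≤ ∣ U ∣ → Resolves H U
  fullyResolved⇒Resolves {H} hH fr {U} 3≤∣U∣ =
    descend n ⊤ (≤-reflexive (∣⊤∣≡n n)) (⊤∈ hH) (subst (3 ≤_) (sym (cong ∣_∣ (∩-identityˡ U))) 3≤∣U∣)
    where
    descend : (k : ℕ) (C : Subset n) → ∣ C ∣ ≤ k → C ∈ H → 3 ≤ ∣ C ∩ U ∣ → Resolves H U
    descend zero C ∣C∣≤0 _ 3≤∣C∩U∣ = ⊥-elim (<⇒≱ (≤-trans (s≤s z≤n) (≤-trans 3≤∣C∩U∣ (∣p∩q∣≤∣p∣ C U))) ∣C∣≤0)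
    descend (suc k) C ∣C∣≤1+k C∈H 3≤∣C∩U∣
      with binary-node hH fr C∈H (≤-trans (≤-trans (n≤1+n 2) 3≤∣C∩U∣) (∣p∩q∣≤∣p∣ C U)) U
    ... | a , b , ca , cb , ∑≡ with ∣ a ∩ U ∣ ≟ 2 | ∣ b ∩ U ∣ ≟ 2
    ...   | yes cut | _       = a , member ca , cut
    ...   | no _    | yes cut = b , member cb , cut
    ...   | no a≢2  | no b≢2 with 3≤+⇒3≤⊎3≤ ∣ a ∩ U ∣ ∣ b ∩ U ∣ (subst (3 ≤_) (sym ∑≡) 3≤∣C∩U∣) a≢2 b≢2
    ...     | inj₁ 3≤∣a∩U∣ = descend k a (below ca) (member ca) 3≤∣a∩U∣
      where below : ∀ {d} → IsChild H C d → ∣ d ∣ ≤ k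
            below c = ≤-pred (≤-trans (⊊⇒∣∣< (proper c)) ∣C∣≤1+k)
    ...     | inj₂ 3≤∣b∩U∣ = descend k b (below cb) (member cb) 3≤∣b∩U∣
      where below : ∀ {d} → IsChild H C d → ∣ d ∣ ≤ k
            below c = ≤-pred (≤-trans (⊊⇒∣∣< (proper c)) ∣C∣≤1+k)

module _ {n : ℕ} where

  -- resolving a polytomy C: merge all children other than a into the new cluster C ∖ a
  module Polytomy {H : Clusters n} (hH : IsHierarchy H) {C : Subset n} (C∈H : C ∈ H)
                  (3≤#children : 3 ≤ length (children H C)) where

    private
      child : {a : Subset n} → a ∈ children H C → IsChild H C a
      child = to ∈-children⇔

      child⊆C : {a : Subset n} → a ∈ children H C → a ⊆ C
      child⊆C = proj₁ ∘ proper ∘ child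

      others : {a : Subset n} → a ∈ children H C →
               ∃₂ λ b c → b ∈ children H C × c ∈ children H C × b ≢ a × c ≢ a × b ≢ c
      others a∈ = two-others (children H C) (children-unique H C) 3≤#children a∈ (≡-dec Bool._≟_)

      element : {a : Subset n} → a ∈ children H C → ∃ λ x → x ∈ₛ a
      element a∈ = 0<∣p∣⇒nonempty _ (∈⇒0<∣∣ hH (member (child a∈)))

    C∖ : Subset n → Subset n
    C∖ a = C ∩ ∁ a

    C∖⊆C : (a : Subset n) → C∖ a ⊆ C
    C∖⊆C a x∈ = proj₁ (x∈p∩q⁻ C (∁ a) x∈)

    sibling⊆C∖ : {a b : Subset n} → a ∈ children H C → b ∈ children H C → b ≢ a → b ⊆ C∖ a
    sibling⊆C∖ {a} {b} a∈ b∈ b≢a {x} x∈b =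
      x∈p∩q⁺ (child⊆C b∈ x∈b , x∉p⇒x∈∁p (λ x∈a → ∉⊥ (subst (x ∈ₛ_) (children-disjoint hH b∈ a∈ b≢a) (x∈p∩q⁺ (x∈b , x∈a)))))

    C∖-new : {a : Subset n} → a ∈ children H C → ¬ C∖ a ∈ H
    C∖-new {a} a∈ C∖a∈H with others a∈
    ... | b , c , b∈ , c∈ , b≢a , c≢a , b≢c =
      maximal (child b∈) C∖a∈H (sibling⊆C∖ a∈ b∈ b≢a , b≢C∖a) (C∖⊆C a , C∖a≢C)
      where
      b≢C∖a : b ≢ C∖ a
      b≢C∖a b≡C∖a with element c∈
      ... | y , y∈c = ∉⊥ (subst (y ∈ₛ_) (children-disjoint hH b∈ c∈ b≢c)
                            (x∈p∩q⁺ (subst (y ∈ₛ_) (sym b≡C∖a) (sibling⊆C∖ a∈ c∈ c≢a y∈c) , y∈c)))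
      C∖a≢C : C∖ a ≢ C
      C∖a≢C C∖a≡C with element a∈
      ... | x , x∈a = x∈∁p⇒x∉p (proj₂ (x∈p∩q⁻ C (∁ a) (subst (x ∈ₛ_) (sym C∖a≡C) (child⊆C a∈ x∈a)))) x∈a

    C∖≢⊥ : {a : Subset n} → a ∈ children H C → C∖ a ≢ ⊥
    C∖≢⊥ a∈ C∖a≡⊥ with others a∈
    ... | b , _ , b∈ , _ , b≢a , _ with element b∈
    ...   | x , x∈b = ∉⊥ (subst (x ∈ₛ_) C∖a≡⊥ (sibling⊆C∖ a∈ b∈ b≢a x∈b))

    C∖-laminar : {a E : Subset n} → a ∈ children H C → E ∈ H → Laminar (C∖ a) E
    C∖-laminar {a} {E} a∈ E∈H with laminar hH C∈H E∈H
    ... | inj₁ C⊆E = inj₁ (⊆-trans (C∖⊆C a) C⊆E)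
    ... | inj₂ (inj₂ C∩E≡⊥) =
      inj₂ (inj₂ (tautology-lift (x₀ ∩ᶠ x₂ ≐ ⊥ᶠ ∷ []) ((x₀ ∩ᶠ ∁ᶠ x₁) ∩ᶠ x₂ ≐ ⊥ᶠ) _ (C ∷ a ∷ E ∷ []) (C∩E≡⊥ ∷ [])))
    ... | inj₂ (inj₁ E⊆C) with ≡-dec Bool._≟_ E C
    ...   | yes refl = inj₁ (C∖⊆C a)
    ...   | no E≢C with ⊊⇒⊆child E∈H (E⊆C , E≢C)
    ...     | d , d∈ , E⊆d with ≡-dec Bool._≟_ d a
    ...       | yes refl = inj₂ (inj₂ (tautology-lift (x₂ ∩ᶠ x₁ ≐ x₂ ∷ []) ((x₀ ∩ᶠ ∁ᶠ x₁) ∩ᶠ x₂ ≐ ⊥ᶠ) _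
                                         (C ∷ a ∷ E ∷ []) (to ⊆⇔∩≡ E⊆d ∷ [])))
    ...       | no d≢a  = inj₂ (inj₁ (⊆-trans E⊆d (sibling⊆C∖ a∈ d∈ d≢a)))

    C∖-hierarchy : {a : Subset n} → a ∈ children H C → IsHierarchy (C∖ a ∷ H)
    C∖-hierarchy {a} a∈ = record
      { ⊤∈ = there (⊤∈ hH)
      ; ⁅⁆∈ = there ∘ ⁅⁆∈ hH
      ; ⊥∉ = λ { (here ⊥≡C∖a) → C∖≢⊥ a∈ (sym ⊥≡C∖a) ; (there ⊥∈H) → ⊥∉ hH ⊥∈H }
      ; laminar = lam }
      where
      lam : ∀ {A B} → A ∈ C∖ a ∷ H → B ∈ C∖ a ∷ H → Laminar A B
      lam (here refl) (here refl) = inj₁ ⊆-refl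
      lam (here refl) (there B∈H) = C∖-laminar a∈ B∈H
      lam (there A∈H) (here refl) = Laminar-sym (C∖-laminar a∈ A∈H)
      lam (there A∈H) (there B∈H) = laminar hH A∈H B∈H

private
  2+x∈[2,3] : ∀ x → 2 + x ≤ 4 → x ≢ 2 → 2 + x ≡ 2 ⊎ 2 + x ≡ 3
  2+x∈[2,3] zero          _ _   = inj₁ refl
  2+x∈[2,3] (suc zero)    _ _   = inj₂ refl
  2+x∈[2,3] (suc (suc zero)) _ x≢2 = ⊥-elim (x≢2 refl)
  2+x∈[2,3] (suc (suc (suc x))) (s≤s (s≤s (s≤s (s≤s ())))) _

  x+y≡3⇒[x≡2]≡[y≡1] : ∀ x y → x + y ≡ 3 → (x ≡ᵇ 2) ≡ (y ≡ᵇ 1)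
  x+y≡3⇒[x≡2]≡[y≡1] zero                   _ refl = refl
  x+y≡3⇒[x≡2]≡[y≡1] (suc zero)             _ refl = refl
  x+y≡3⇒[x≡2]≡[y≡1] (suc (suc zero))       _ refl = refl
  x+y≡3⇒[x≡2]≡[y≡1] (suc (suc (suc zero))) _ refl = refl

  x≡𝟙[x≡1]+3𝟙[x≡3] : ∀ x → x ≤ 3 → x ≢ 2 → x ≡ 𝟙 (x ≡ᵇ 1) + 3 * 𝟙 (x ≡ᵇ 3)
  x≡𝟙[x≡1]+3𝟙[x≡3] zero                _ _   = refl
  x≡𝟙[x≡1]+3𝟙[x≡3] (suc zero)          _ _   = refl
  x≡𝟙[x≡1]+3𝟙[x≡3] (suc (suc zero))    _ x≢2 = ⊥-elim (x≢2 refl)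
  x≡𝟙[x≡1]+3𝟙[x≡3] (suc (suc (suc zero))) _ _ = refl
  x≡𝟙[x≡1]+3𝟙[x≡3] (suc (suc (suc (suc x)))) (s≤s (s≤s (s≤s ()))) _

  𝟙[a∧¬b]+𝟙[a∧b]≡𝟙[a] : ∀ a b → 𝟙 (a ∧ not b) + 𝟙 (a ∧ b) ≡ 𝟙 a
  𝟙[a∧¬b]+𝟙[a∧b]≡𝟙[a] true  true  = refl
  𝟙[a∧¬b]+𝟙[a∧b]≡𝟙[a] true  false = refl
  𝟙[a∧¬b]+𝟙[a∧b]≡𝟙[a] false _     = refl

  -- N₁ (N₃) children meet a 3-set in one (three) taxa, so N₁ ∈ {0, 3}; g + b splits N₁ with b ≤ 1
  two-thirds : ∀ N₁ N₃ g b → 3 ≡ N₁ + 3 * N₃ → g + b ≡ N₁ → b ≤ 1 → 2 * N₁ ≤ 3 * g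
  two-thirds N₁ zero g zero 3≡N₁ g+b≡N₁ _
    rewrite sym (trans 3≡N₁ (+-identityʳ N₁)) | +-identityʳ g | g+b≡N₁ = s≤s (s≤s (s≤s (s≤s (s≤s (s≤s z≤n)))))
  two-thirds N₁ zero g (suc zero) 3≡N₁ g+1≡N₁ _
    rewrite sym (trans 3≡N₁ (+-identityʳ N₁)) with +-cancelʳ-≡ 1 g 2 g+1≡N₁
  ... | refl = s≤s (s≤s (s≤s (s≤s (s≤s (s≤s z≤n)))))
  two-thirds N₁ zero g (suc (suc b)) _ _ (s≤s ())
  two-thirds N₁ (suc N₃) g b 3≡N₁+3N₃ _ _
    with n≤0⇒n≡0 (+-cancelʳ-≤ 3 N₁ 0 (≤-trans (+-monoʳ-≤ N₁ (*-monoʳ-≤ 3 (s≤s (z≤n {N₃})))) (≤-reflexive (sym 3≡N₁+3N₃))))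
  ... | refl = z≤n

module _ {n : ℕ} where

  -- among the ways C ∖ a of resolving a polytomy C, those resolving a unit U uncut by H come in
  -- a group of three, of which at most one matches G on U
  module UnitAtPolytomy {H G : Clusters n} (hH : IsHierarchy H) (hG : IsHierarchy G)
                        {C : Subset n} (C∈H : C ∈ H) (2≤∣C∣ : 2 ≤ ∣ C ∣) (3≤#children : 3 ≤ length (children H C))
                        {U : Subset n} (unit : IsUnit U) (uncut : ∀ {K} → K ∈ H → ∣ K ∩ U ∣ ≢ 2) where

    open Polytomy hH C∈H 3≤#children
    open Node hH C∈H 2≤∣C∣ using (child⊆; ∑children)

    resolving compatible conflicting : Subset n → Bool
    resolving   a = cutsᵇ (C∖ a) U
    compatible  a = resolving a ∧ matchedᵇ G U (C∖ a)
    conflicting a = resolving a ∧ not (matchedᵇ G U (C∖ a))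

    private
      L : List (Subset n)
      L = children H C

      ∣C∩U∣≤4 : ∣ C ∩ U ∣ ≤ 4
      ∣C∩U∣≤4 = ≤-trans (p⊆q⇒∣p∣≤∣q∣ (p∩q⊆q C U)) ([ (λ e → ≤-trans (≤-reflexive e) (n≤1+n 3)) , ≤-reflexive ]′ unit)

      sizes : {a : Subset n} → a ∈ L → ∣ C∖ a ∩ U ∣ + ∣ a ∩ U ∣ ≡ ∣ C ∩ U ∣
      sizes a∈ = ∣C∖a∩U∣+∣a∩U∣≡∣C∩U∣ U (child⊆ a∈)

      2+∣a∩U∣≡∣C∩U∣ : {a : Subset n} → a ∈ L → T (resolving a) → 2 + ∣ a ∩ U ∣ ≡ ∣ C ∩ U ∣
      2+∣a∩U∣≡∣C∩U∣ {a} a∈ r = trans (cong (_+ ∣ a ∩ U ∣) (sym (to (T-cutsᵇ (C∖ a) U) r))) (sizes a∈)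

      ¬resolving : ∣ C ∩ U ∣ ≢ 3 → {a : Subset n} → a ∈ L → ¬ T (resolving a)
      ¬resolving ∣C∩U∣≢3 {a} a∈ r =
        [ uncut C∈H ∘ trans (sym (2+∣a∩U∣≡∣C∩U∣ a∈ r)) , ∣C∩U∣≢3 ∘ trans (sym (2+∣a∩U∣≡∣C∩U∣ a∈ r)) ]′
          (2+x∈[2,3] ∣ a ∩ U ∣ (subst (_≤ 4) (sym (2+∣a∩U∣≡∣C∩U∣ a∈ r)) ∣C∩U∣≤4) (uncut (member (to ∈-children⇔ a∈))))

      module ThreeTaxaInC (∣C∩U∣≡3 : ∣ C ∩ U ∣ ≡ 3) where

        𝟙-resolving : {a : Subset n} → a ∈ L → 𝟙 (resolving a) ≡ 𝟙 (∣ a ∩ U ∣ ≡ᵇ 1)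
        𝟙-resolving {a} a∈ = cong 𝟙 (x+y≡3⇒[x≡2]≡[y≡1] ∣ C∖ a ∩ U ∣ ∣ a ∩ U ∣ (trans (sizes a∈) ∣C∩U∣≡3))

        ∣C∖a∩C∖b∩U∣≡1 : {a b : Subset n} → a ∈ L → b ∈ L → a ≢ b → T (resolving a) → T (resolving b) →
                         ∣ (C∖ a ∩ U) ∩ (C∖ b ∩ U) ∣ ≡ 1
        ∣C∖a∩C∖b∩U∣≡1 {a} {b} a∈ b∈ a≢b ra rb = +-cancelˡ-≡ 2 _ _ (begin
          2 + ∣ (C∖ a ∩ U) ∩ (C∖ b ∩ U) ∣                     ≡⟨ cong₂ (λ k m → k + ∣ m ∣) ∣C∩U∩[a∪b]∣≡2 (sym C∖a∩C∖b∩U) ⟨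
          ∣ (C ∩ U) ∩ (a ∪ b) ∣ + ∣ (C ∩ U) ∩ ∁ (a ∪ b) ∣     ≡⟨ ∣p∣≡∣p∩q∣+∣p∩∁q∣ (C ∩ U) (a ∪ b) ⟨
          ∣ C ∩ U ∣                                           ≡⟨ ∣C∩U∣≡3 ⟩
          3                                                   ∎)
          where
          open ≡-Reasoning
          C∖a∩C∖b∩U : (C∖ a ∩ U) ∩ (C∖ b ∩ U) ≡ (C ∩ U) ∩ ∁ (a ∪ b)
          C∖a∩C∖b∩U = identity (((x₀ ∩ᶠ ∁ᶠ x₂) ∩ᶠ x₁) ∩ᶠ ((x₀ ∩ᶠ ∁ᶠ x₃) ∩ᶠ x₁) ≐ (x₀ ∩ᶠ x₁) ∩ᶠ ∁ᶠ (x₂ ∪ᶠ x₃)) _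
                        (C ∷ U ∷ a ∷ b ∷ [])
          ∣a∩U∣≡1 : ∀ {d} → d ∈ L → T (resolving d) → ∣ d ∩ U ∣ ≡ 1
          ∣a∩U∣≡1 d∈ rd = +-cancelˡ-≡ 2 _ _ (trans (2+∣a∩U∣≡∣C∩U∣ d∈ rd) ∣C∩U∣≡3)
          ∣C∩U∩[a∪b]∣≡2 : ∣ (C ∩ U) ∩ (a ∪ b) ∣ ≡ 2
          ∣C∩U∩[a∪b]∣≡2 = begin
            ∣ (C ∩ U) ∩ (a ∪ b) ∣     ≡⟨ cong ∣_∣ (tautology-lift (x₂ ∩ᶠ x₀ ≐ x₂ ∷ x₃ ∩ᶠ x₀ ≐ x₃ ∷ [])
                                           ((x₀ ∩ᶠ x₁) ∩ᶠ (x₂ ∪ᶠ x₃) ≐ (x₂ ∩ᶠ x₁) ∪ᶠ (x₃ ∩ᶠ x₁)) _ (C ∷ U ∷ a ∷ b ∷ [])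
                                           (to ⊆⇔∩≡ (child⊆ a∈) ∷ to ⊆⇔∩≡ (child⊆ b∈) ∷ [])) ⟩
            ∣ (a ∩ U) ∪ (b ∩ U) ∣     ≡⟨ ∣p∪q∣≡∣p∣+∣q∣ (a ∩ U) (b ∩ U)
                                           (tautology-lift (x₀ ∩ᶠ x₁ ≐ ⊥ᶠ ∷ []) ((x₀ ∩ᶠ x₂) ∩ᶠ (x₁ ∩ᶠ x₂) ≐ ⊥ᶠ) _
                                             (a ∷ b ∷ U ∷ []) (children-disjoint hH a∈ b∈ a≢b ∷ [])) ⟩
            ∣ a ∩ U ∣ + ∣ b ∩ U ∣     ≡⟨ cong₂ _+_ (∣a∩U∣≡1 a∈ ra) (∣a∩U∣≡1 b∈ rb) ⟩
            2                         ∎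

        ¬two-compatible : {a b : Subset n} → a ∈ L → b ∈ L → a ≢ b → T (compatible a) → ¬ T (compatible b)
        ¬two-compatible {a} {b} a∈ b∈ a≢b ca cb with to (T-∧ {resolving a}) ca | to (T-∧ {resolving b}) cb
        ... | ra , ma | rb , mb with to (T-matchedᵇ G U (C∖ a)) ma | to (T-matchedᵇ G U (C∖ b)) mb
        ... | B , B∈G , cutB , a~B | B′ , B′∈G , cutB′ , b~B′ with same
          where
          same : SameSplit U (C∖ a) (C∖ b)
          same = SameSplit-trans a~B (SameSplit-trans (cut-unique hG unit B∈G B′∈G cutB cutB′) (SameSplit-sym b~B′))
        ... | inj₁ e = 1+n≢n {1} (begin
              2                                   ≡⟨ to (T-cutsᵇ (C∖ a) U) ra ⟨
              ∣ C∖ a ∩ U ∣                        ≡⟨ cong ∣_∣ (∩-idem (C∖ a ∩ U)) ⟨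
              ∣ (C∖ a ∩ U) ∩ (C∖ a ∩ U) ∣         ≡⟨ cong (λ m → ∣ (C∖ a ∩ U) ∩ m ∣) e ⟩
              ∣ (C∖ a ∩ U) ∩ (C∖ b ∩ U) ∣         ≡⟨ ∣C∖a∩C∖b∩U∣≡1 a∈ b∈ a≢b ra rb ⟩
              1                                   ∎)
          where open ≡-Reasoning
        ... | inj₂ e = 0≢1+n (begin
              0                                   ≡⟨ ∣⊥∣≡0 n ⟨
              ∣ ⊥ {n} ∣                           ≡⟨ cong ∣_∣ (identity ((x₀ ∩ᶠ ∁ᶠ x₁) ∩ᶠ (x₁ ∩ᶠ x₀) ≐ ⊥ᶠ) _ (U ∷ C∖ b ∷ [])) ⟨
              ∣ (U ∩ ∁ (C∖ b)) ∩ (C∖ b ∩ U) ∣     ≡⟨ cong (λ m → ∣ m ∩ (C∖ b ∩ U) ∣) e ⟨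
              ∣ (C∖ a ∩ U) ∩ (C∖ b ∩ U) ∣         ≡⟨ ∣C∖a∩C∖b∩U∣≡1 a∈ b∈ a≢b ra rb ⟩
              1                                   ∎)
          where open ≡-Reasoning

        bound₃ : 2 * ∑ L (𝟙 ∘ resolving) ≤ 3 * ∑ L (𝟙 ∘ conflicting)
        bound₃ = subst (λ r → 2 * r ≤ 3 * ∑ L (𝟙 ∘ conflicting)) (sym ∑resolving≡N₁)
                   (two-thirds N₁ N₃ (∑ L (𝟙 ∘ conflicting)) (∑ L (𝟙 ∘ compatible)) 3≡N₁+3N₃ split
                     (∑𝟙≤1 L (children-unique H C) compatible ¬two-compatible))
          where
          N₁ N₃ : ℕ
          N₁ = ∑ L (λ a → 𝟙 (∣ a ∩ U ∣ ≡ᵇ 1))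
          N₃ = ∑ L (λ a → 𝟙 (∣ a ∩ U ∣ ≡ᵇ 3))
          ∑resolving≡N₁ : ∑ L (𝟙 ∘ resolving) ≡ N₁
          ∑resolving≡N₁ = ∑-cong L (λ a a∈ → 𝟙-resolving a∈)
          3≡N₁+3N₃ : 3 ≡ N₁ + 3 * N₃
          3≡N₁+3N₃ = begin
            3                                      ≡⟨ ∣C∩U∣≡3 ⟨
            ∣ C ∩ U ∣                              ≡⟨ ∑children U ⟨
            ∑ L (λ a → ∣ a ∩ U ∣)                  ≡⟨ ∑-cong L (λ a a∈ → x≡𝟙[x≡1]+3𝟙[x≡3] _ (∣a∩U∣≤3 a∈) (uncut (member (to ∈-children⇔ a∈)))) ⟩
            ∑ L (λ a → 𝟙 (∣ a ∩ U ∣ ≡ᵇ 1) + 3 * 𝟙 (∣ a ∩ U ∣ ≡ᵇ 3)) ≡⟨ ∑-+ L _ _ ⟩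
            N₁ + ∑ L (λ a → 3 * 𝟙 (∣ a ∩ U ∣ ≡ᵇ 3)) ≡⟨ cong (N₁ +_) (∑-* L 3 _) ⟩
            N₁ + 3 * N₃                            ∎
            where
            open ≡-Reasoning
            ∣a∩U∣≤3 : ∀ {a} → a ∈ L → ∣ a ∩ U ∣ ≤ 3
            ∣a∩U∣≤3 a∈ = ≤-trans (≤∑ L (λ a → ∣ a ∩ U ∣) a∈) (≤-reflexive (trans (∑children U) ∣C∩U∣≡3))
          split : ∑ L (𝟙 ∘ conflicting) + ∑ L (𝟙 ∘ compatible) ≡ N₁
          split = trans (sym (∑-+ L _ _))
                        (trans (∑-cong L (λ a _ → 𝟙[a∧¬b]+𝟙[a∧b]≡𝟙[a] (resolving a) (matchedᵇ G U (C∖ a)))) ∑resolving≡N₁)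

    bound : 2 * ∑ (children H C) (𝟙 ∘ resolving) ≤ 3 * ∑ (children H C) (𝟙 ∘ conflicting)
    bound with ∣ C ∩ U ∣ ≟ 3
    ... | yes ∣C∩U∣≡3 = ThreeTaxaInC.bound₃ ∣C∩U∣≡3
    ... | no  ∣C∩U∣≢3 = subst (λ r → 2 * r ≤ 3 * ∑ L (𝟙 ∘ conflicting)) (sym (∑-zero L (λ a a∈ → 𝟙-false (¬resolving ∣C∩U∣≢3 a∈)))) z≤n

private
  𝟙[[p∧q∧¬r]∧r]≡0 : ∀ p q r → 𝟙 ((p ∧ q ∧ not r) ∧ r) ≡ 0
  𝟙[[p∧q∧¬r]∧r]≡0 false _     _     = refl
  𝟙[[p∧q∧¬r]∧r]≡0 true  false _     = refl
  𝟙[[p∧q∧¬r]∧r]≡0 true  true  true  = refl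
  𝟙[[p∧q∧¬r]∧r]≡0 true  true  false = refl

  𝟙-∧-T : ∀ {a b} → T b → 𝟙 (a ∧ b) ≡ 𝟙 a
  𝟙-∧-T {a} b = cong 𝟙 (trans (cong (a ∧_) (T⇒≡true b)) (∧-identityʳ a))

  resolved-step : ∀ o c r → 𝟙 (o ∧ (c ∨ r)) ≡ 𝟙 (o ∧ r) + 𝟙 (o ∧ not r ∧ c)
  resolved-step false _     _     = refl
  resolved-step true  true  true  = refl
  resolved-step true  false true  = refl
  resolved-step true  true  false = refl
  resolved-step true  false false = refl

  -- o: U ∈ 𝓡₂; c: the new cluster cuts U; r: U was resolved; a, a′: agreement before and after;
  -- m: the new cut is matched
  conflict-step : ∀ o c r a a′ m → (T o → T r → a′ ≡ a) → (¬ T r → a′ ≡ c ∧ m) →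
                  𝟙 (o ∧ (c ∨ r) ∧ not a′) ≡ 𝟙 (o ∧ r ∧ not a) + 𝟙 (o ∧ not r ∧ c ∧ not m)
  conflict-step false _ _ _ _ _ _ _ = refl
  conflict-step true c true a a′ m same _ rewrite same _ _ with c
  ... | true  = sym (+-identityʳ _)
  ... | false = sym (+-identityʳ _)
  conflict-step true c false a a′ m _ new rewrite new (λ ()) with c
  ... | true  = refl
  ... | false = refl

module _ {n : ℕ} where

  agreeᵇ-∷-resolved : {K : Subset n} {H : Clusters n} (G : Clusters n) → IsHierarchy (K ∷ H) →
                      {U : Subset n} → IsUnit U → T (resolvesᵇ H U) → agreeᵇ (K ∷ H) G U ≡ agreeᵇ H G U
  agreeᵇ-∷-resolved {K} {H} G hKH {U} unit r = T-⇔⇒≡ (mk⇔ ⇒ ⇐)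
    where
    ⇒ : T (agreeᵇ (K ∷ H) G U) → T (agreeᵇ H G U)
    ⇒ a with to (T-agreeᵇ (K ∷ H) G U) a
    ... | K′ , there K′∈H , cut , m = from (T-agreeᵇ H G U) (K′ , K′∈H , cut , m)
    ... | K′ , here refl  , cut , B , B∈G , cutB , K~B with to (T-resolvesᵇ H U) r
    ...   | K₀ , K₀∈H , cut₀ =
      from (T-agreeᵇ H G U) (K₀ , K₀∈H , cut₀ , B , B∈G , cutB , SameSplit-trans (cut-unique hKH unit (there K₀∈H) (here refl) cut₀ cut) K~B)
    ⇐ : T (agreeᵇ H G U) → T (agreeᵇ (K ∷ H) G U)
    ⇐ a = let (K′ , K′∈H , rest) = to (T-agreeᵇ H G U) a in from (T-agreeᵇ (K ∷ H) G U) (K′ , there K′∈H , rest)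

  agreeᵇ-∷-unresolved : {K : Subset n} {H : Clusters n} (G : Clusters n) {U : Subset n} → ¬ T (resolvesᵇ H U) →
                        agreeᵇ (K ∷ H) G U ≡ cutsᵇ K U ∧ matchedᵇ G U K
  agreeᵇ-∷-unresolved {K} {H} G {U} ¬r = T-⇔⇒≡ (mk⇔ ⇒ ⇐)
    where
    ⇒ : T (agreeᵇ (K ∷ H) G U) → T (cutsᵇ K U ∧ matchedᵇ G U K)
    ⇒ a with to (T-agreeᵇ (K ∷ H) G U) a
    ... | K′ , there K′∈H , cut , _ = ⊥-elim (¬r (from (T-resolvesᵇ H U) (K′ , K′∈H , cut)))
    ... | K′ , here refl  , cut , m = from (T-∧ {cutsᵇ K U}) (from (T-cutsᵇ K U) cut , from (T-matchedᵇ G U K) m)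
    ⇐ : T (cutsᵇ K U ∧ matchedᵇ G U K) → T (agreeᵇ (K ∷ H) G U)
    ⇐ h = let (cut , m) = to (T-∧ {cutsᵇ K U}) h
          in from (T-agreeᵇ (K ∷ H) G U) (K , here refl , to (T-cutsᵇ K U) cut , to (T-matchedᵇ G U K) m)

  module Refinement (P : Subset n → Bool) (P⇒unit : ∀ U → T (P U) → IsUnit U)
                    (T₁ T₂ : Clusters n) (hT₂ : IsHierarchy T₂) where

    onlyT₂ : Subset n → Bool
    onlyT₂ U = P U ∧ resolvesᵇ T₂ U ∧ not (resolvesᵇ T₁ U)

    #resolved #conflicting : Clusters n → ℕ
    #resolved H = ∑ (subsets n) (λ U → 𝟙 (onlyT₂ U ∧ resolvesᵇ H U))
    #conflicting H = ∑ (subsets n) (λ U → 𝟙 (onlyT₂ U ∧ resolvesᵇ H U ∧ not (agreeᵇ H T₂ U)))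

    Balanced : Clusters n → Set
    Balanced H = 2 * #resolved H ≤ 3 * #conflicting H

    resolvedGain conflictGain : Clusters n → Subset n → Subset n → ℕ
    resolvedGain H K U = 𝟙 (onlyT₂ U ∧ not (resolvesᵇ H U) ∧ cutsᵇ K U)
    conflictGain H K U = 𝟙 (onlyT₂ U ∧ not (resolvesᵇ H U) ∧ cutsᵇ K U ∧ not (matchedᵇ T₂ U K))

    #resolved-∷ : (K : Subset n) (H : Clusters n) → #resolved (K ∷ H) ≡ #resolved H + ∑ (subsets n) (resolvedGain H K)
    #resolved-∷ K H = trans (∑-cong (subsets n) (λ U _ → per-unit U)) (∑-+ (subsets n) _ _)
      where
      per-unit : ∀ U → 𝟙 (onlyT₂ U ∧ resolvesᵇ (K ∷ H) U) ≡ 𝟙 (onlyT₂ U ∧ resolvesᵇ H U) + resolvedGain H K U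
      per-unit U = trans (cong (λ r → 𝟙 (onlyT₂ U ∧ r)) (resolvesᵇ-∷ K H U)) (resolved-step (onlyT₂ U) (cutsᵇ K U) (resolvesᵇ H U))

    onlyT₂⇒unit : {U : Subset n} → T (onlyT₂ U) → IsUnit U
    onlyT₂⇒unit {U} = P⇒unit U ∘ proj₁ ∘ to (T-∧ {P U})

    #conflicting-∷ : (K : Subset n) (H : Clusters n) → IsHierarchy (K ∷ H) →
                     #conflicting (K ∷ H) ≡ #conflicting H + ∑ (subsets n) (conflictGain H K)
    #conflicting-∷ K H hKH = trans (∑-cong (subsets n) (λ U _ → per-unit U)) (∑-+ (subsets n) _ _)
      where
      per-unit : ∀ U → 𝟙 (onlyT₂ U ∧ resolvesᵇ (K ∷ H) U ∧ not (agreeᵇ (K ∷ H) T₂ U)) ≡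
                       𝟙 (onlyT₂ U ∧ resolvesᵇ H U ∧ not (agreeᵇ H T₂ U)) + conflictGain H K U
      per-unit U = trans (cong (λ r → 𝟙 (onlyT₂ U ∧ r ∧ not (agreeᵇ (K ∷ H) T₂ U))) (resolvesᵇ-∷ K H U))
                         (conflict-step (onlyT₂ U) (cutsᵇ K U) (resolvesᵇ H U) (agreeᵇ H T₂ U) (agreeᵇ (K ∷ H) T₂ U) (matchedᵇ T₂ U K)
                           (λ only → agreeᵇ-∷-resolved T₂ hKH (onlyT₂⇒unit only)) (agreeᵇ-∷-unresolved {K} {H} T₂ {U}))

    Balanced-∷ : (K : Subset n) (H : Clusters n) → IsHierarchy (K ∷ H) → Balanced H →
                 2 * ∑ (subsets n) (resolvedGain H K) ≤ 3 * ∑ (subsets n) (conflictGain H K) → Balanced (K ∷ H)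
    Balanced-∷ K H hKH balanced gains = begin
      2 * #resolved (K ∷ H)                                  ≡⟨ cong (2 *_) (#resolved-∷ K H) ⟩
      2 * (#resolved H + ∑ (subsets n) (resolvedGain H K))   ≡⟨ *-distribˡ-+ 2 (#resolved H) _ ⟩
      2 * #resolved H + 2 * ∑ (subsets n) (resolvedGain H K) ≤⟨ +-mono-≤ balanced gains ⟩
      3 * #conflicting H + 3 * ∑ (subsets n) (conflictGain H K) ≡⟨ *-distribˡ-+ 3 (#conflicting H) _ ⟨
      3 * (#conflicting H + ∑ (subsets n) (conflictGain H K))   ≡⟨ cong (3 *_) (#conflicting-∷ K H hKH) ⟨
      3 * #conflicting (K ∷ H)                                  ∎
      where open ≤-Reasoning

    private
      gains-vanish : {H : Clusters n} {U : Subset n} → ¬ T (onlyT₂ U) ⊎ T (resolvesᵇ H U) →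
                     (K : Subset n) → resolvedGain H K U ≡ 0
      gains-vanish {H} {U} excl K = 𝟙-false λ g →
        let (only , g′) = to (T-∧ {onlyT₂ U}) g ; (¬r , _) = to (T-∧ {not (resolvesᵇ H U)}) g′
        in [ (λ ¬only → ¬only only) , to T-not ¬r ]′ excl

      gains-unresolved : {H : Clusters n} {U : Subset n} → T (onlyT₂ U) → ¬ T (resolvesᵇ H U) → (K : Subset n) →
                         resolvedGain H K U ≡ 𝟙 (cutsᵇ K U) × conflictGain H K U ≡ 𝟙 (cutsᵇ K U ∧ not (matchedᵇ T₂ U K))
      gains-unresolved {H} {U} only ¬r K =
        cong₂ (λ o r → 𝟙 (o ∧ not r ∧ cutsᵇ K U)) (T⇒≡true only) (¬T⇒≡false ¬r) ,
        cong₂ (λ o r → 𝟙 (o ∧ not r ∧ cutsᵇ K U ∧ not (matchedᵇ T₂ U K))) (T⇒≡true only) (¬T⇒≡false ¬r)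

    -- by averaging over the children a of C
    best-split : {H : Clusters n} → IsHierarchy H → {C : Subset n} → C ∈ H → 2 ≤ ∣ C ∣ → 3 ≤ length (children H C) →
                 ∃ λ a → a ∈ children H C ×
                   2 * ∑ (subsets n) (resolvedGain H (C ∩ ∁ a)) ≤ 3 * ∑ (subsets n) (conflictGain H (C ∩ ∁ a))
    best-split {H} hH {C} C∈H 2≤∣C∣ 3≤# =
      ∑-≤⇒∃-≤ L (λ a → 3 * ∑ (subsets n) (conflictGain H (C ∩ ∁ a))) (λ a → 2 * ∑ (subsets n) (resolvedGain H (C ∩ ∁ a)))
        total (nonempty L 3≤#)
      where
      L : List (Subset n)
      L = children H C
      nonempty : (xs : List (Subset n)) → 3 ≤ length xs → ∃ λ x → x ∈ xs
      nonempty (x ∷ _) _ = x , here refl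
      per-unit : ∀ U → U ∈ subsets n →
                 ∑ L (λ a → 2 * resolvedGain H (C ∩ ∁ a) U) ≤ ∑ L (λ a → 3 * conflictGain H (C ∩ ∁ a) U)
      per-unit U _ with T? (onlyT₂ U) | T? (resolvesᵇ H U)
      ... | no ¬only | _ = ≤-trans (≤-reflexive (∑-zero L (λ a _ → cong (2 *_) (gains-vanish {H} (inj₁ ¬only) (C ∩ ∁ a))))) z≤n
      ... | yes _    | yes r = ≤-trans (≤-reflexive (∑-zero L (λ a _ → cong (2 *_) (gains-vanish {H} (inj₂ r) (C ∩ ∁ a))))) z≤n
      ... | yes only | no ¬r =
        subst₂ _≤_ (trans (sym (∑-* L 2 _)) (∑-cong L (λ a _ → cong (2 *_) (sym (proj₁ (gains-unresolved {H} only ¬r (C ∩ ∁ a)))))))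
                   (trans (sym (∑-* L 3 _)) (∑-cong L (λ a _ → cong (3 *_) (sym (proj₂ (gains-unresolved {H} only ¬r (C ∩ ∁ a)))))))
          (UnitAtPolytomy.bound hH hT₂ C∈H 2≤∣C∣ 3≤# (onlyT₂⇒unit only) (λ K∈H cut → ¬r (from (T-resolvesᵇ H U) (_ , K∈H , cut))))
      total : ∑ L (λ a → 2 * ∑ (subsets n) (resolvedGain H (C ∩ ∁ a))) ≤ ∑ L (λ a → 3 * ∑ (subsets n) (conflictGain H (C ∩ ∁ a)))
      total = begin
        ∑ L (λ a → 2 * ∑ (subsets n) (resolvedGain H (C ∩ ∁ a)))   ≡⟨ ∑-cong L (λ a _ → ∑-* (subsets n) 2 _) ⟨
        ∑ L (λ a → ∑ (subsets n) (λ U → 2 * resolvedGain H (C ∩ ∁ a) U)) ≡⟨ ∑-swap L (subsets n) _ ⟩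
        ∑ (subsets n) (λ U → ∑ L (λ a → 2 * resolvedGain H (C ∩ ∁ a) U)) ≤⟨ ∑-mono (subsets n) per-unit ⟩
        ∑ (subsets n) (λ U → ∑ L (λ a → 3 * conflictGain H (C ∩ ∁ a) U)) ≡⟨ ∑-swap L (subsets n) _ ⟨
        ∑ L (λ a → ∑ (subsets n) (λ U → 3 * conflictGain H (C ∩ ∁ a) U)) ≡⟨ ∑-cong L (λ a _ → ∑-* (subsets n) 3 _) ⟩
        ∑ L (λ a → 3 * ∑ (subsets n) (conflictGain H (C ∩ ∁ a)))   ∎
        where open ≤-Reasoning

    #missing : Clusters n → ℕ
    #missing H = ∑ (subsets n) (λ X → 𝟙 (not (X ∈ᶜ H)))

    #missing-∷ : {K : Subset n} {H : Clusters n} → ¬ K ∈ H → #missing (K ∷ H) < #missing H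
    #missing-∷ {K} {H} K∉H = ∑-mono-< (subsets n) (λ X _ → fewer (X == K) (X ∈ᶜ H)) (∈-subsets K) new
      where
      fewer : ∀ a b → 𝟙 (not (a ∨ b)) ≤ 𝟙 (not b)
      fewer true  b     = z≤n
      fewer false true  = z≤n
      fewer false false = ≤-refl
      new : 𝟙 (not (K ∈ᶜ (K ∷ H))) < 𝟙 (not (K ∈ᶜ H))
      new = subst₂ (λ a b → 𝟙 (not a) < 𝟙 (not b)) (sym (T⇒≡true (from (T-∈ᶜ {C = K} {H = K ∷ H}) (here refl))))
                   (sym (¬T⇒≡false (K∉H ∘ to T-∈ᶜ))) (s≤s z≤n)

    private
      refine : (fuel : ℕ) (H : Clusters n) → #missing H < fuel → IsHierarchy H → (∀ {C} → C ∈ T₁ → C ∈ H) → Balanced H →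
               ∃ λ t → IsHierarchy t × T (isFullyResolved t) × (∀ {C} → C ∈ T₁ → C ∈ t) × Balanced t
      refine (suc fuel) H bound hH T₁⊆H balanced = step (T? (isFullyResolved H))
        where
        step : Dec (T (isFullyResolved H)) →
               ∃ λ t → IsHierarchy t × T (isFullyResolved t) × (∀ {C} → C ∈ T₁ → C ∈ t) × Balanced t
        step (yes fr) = H , hH , fr , T₁⊆H , balanced
        step (no ¬fr) =
          let (C , C∈H , 2≤∣C∣ , 3≤#) = ¬fullyResolved⇒polytomy hH ¬fr
              (a , a∈ , gains) = best-split hH C∈H 2≤∣C∣ 3≤#
              hC∖a = Polytomy.C∖-hierarchy hH C∈H 3≤# a∈
          in refine fuel (C ∩ ∁ a ∷ H) (≤-trans (#missing-∷ (Polytomy.C∖-new hH C∈H 3≤# a∈)) (≤-pred bound))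
                    hC∖a (there ∘ T₁⊆H) (Balanced-∷ (C ∩ ∁ a) H hC∖a balanced gains)

    Balanced-T₁ : Balanced T₁
    Balanced-T₁ = subst (λ r → 2 * r ≤ 3 * #conflicting T₁) (sym (∑-zero (subsets n) unresolved)) z≤n
      where
      unresolved : ∀ U → U ∈ subsets n → 𝟙 (onlyT₂ U ∧ resolvesᵇ T₁ U) ≡ 0
      unresolved U _ = 𝟙[[p∧q∧¬r]∧r]≡0 (P U) (resolvesᵇ T₂ U) (resolvesᵇ T₁ U)

    balanced-refinement : IsHierarchy T₁ →
                          ∃ λ t → IsHierarchy t × T (isFullyResolved t) × (∀ {C} → C ∈ T₁ → C ∈ t) × Balanced t
    balanced-refinement hT₁ = refine (suc (#missing T₁)) T₁ ≤-refl hT₁ (λ C∈ → C∈) Balanced-T₁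

    #resolved-fullyResolved : {t : Clusters n} → IsHierarchy t → T (isFullyResolved t) →
                              #resolved t ≡ ∑ (subsets n) (𝟙 ∘ onlyT₂)
    #resolved-fullyResolved {t} ht fr = ∑-cong (subsets n) resolved
      where
      resolved : ∀ U → U ∈ subsets n → 𝟙 (onlyT₂ U ∧ resolvesᵇ t U) ≡ 𝟙 (onlyT₂ U)
      resolved U _ with T? (onlyT₂ U)
      ... | no ¬only = trans (𝟙-false (¬only ∘ proj₁ ∘ to (T-∧ {onlyT₂ U}))) (sym (𝟙-false ¬only))
      ... | yes only = 𝟙-∧-T {onlyT₂ U} (from (T-resolvesᵇ t U) (fullyResolved⇒Resolves ht fr {U} (IsUnit⇒3≤∣∣ {U = U} (onlyT₂⇒unit only))))

module _ {n : ℕ} where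

  _≈ᶜ_ : Clusters n → Clusters n → Set
  H ≈ᶜ H′ = ∀ {C} → C ∈ H ⇔ C ∈ H′

  ∈ᶜ-resp : {H H′ : Clusters n} → H ≈ᶜ H′ → (C : Subset n) → (C ∈ᶜ H) ≡ (C ∈ᶜ H′)
  ∈ᶜ-resp H≈H′ C = T-⇔⇒≡ (mk⇔ (from T-∈ᶜ ∘ to H≈H′ ∘ to T-∈ᶜ) (from T-∈ᶜ ∘ from H≈H′ ∘ to T-∈ᶜ))

  isChild-resp : {H H′ : Clusters n} → H ≈ᶜ H′ → (C D : Subset n) → isChild H C D ≡ isChild H′ C D
  isChild-resp {H} {H′} H≈H′ C D = T-⇔⇒≡ (mk⇔ (from T-isChild ∘ transport H≈H′ ∘ to T-isChild)
                                               (from T-isChild ∘ transport (mk⇔ (from H≈H′) (to H≈H′)) ∘ to T-isChild))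
    where
    transport : {G G′ : Clusters n} → G ≈ᶜ G′ → IsChild G C D → IsChild G′ C D
    transport G≈G′ c = record { member = to G≈G′ (member c) ; proper = proper c
                              ; maximal = λ E∈G′ → maximal c (from G≈G′ E∈G′) }

  isFullyResolved-resp : {H H′ : Clusters n} → H ≈ᶜ H′ → isFullyResolved H ≡ isFullyResolved H′
  isFullyResolved-resp {H} {H′} H≈H′ = cong and (map-cong node-ok (subsets n))
    where
    #children≡ : ∀ C → numChildren H C ≡ numChildren H′ C
    #children≡ C = trans (length-filter≡∑𝟙 (isChild H C) (subsets n))
                         (trans (∑-cong (subsets n) (λ D _ → cong 𝟙 (isChild-resp H≈H′ C D)))
                                (sym (length-filter≡∑𝟙 (isChild H′ C) (subsets n))))
    node-ok : ∀ C → (not (C ∈ᶜ H) ∨ (∣ C ∣ ≤ᵇ 1) ∨ (numChildren H C ≡ᵇ 2)) ≡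
                    (not (C ∈ᶜ H′) ∨ (∣ C ∣ ≤ᵇ 1) ∨ (numChildren H′ C ≡ᵇ 2))
    node-ok C = cong₂ (λ m k → not m ∨ (∣ C ∣ ≤ᵇ 1) ∨ (k ≡ᵇ 2)) (∈ᶜ-resp H≈H′ C) (#children≡ C)

  resolvesᵇ-resp : {H H′ : Clusters n} → H ≈ᶜ H′ → (U : Subset n) → resolvesᵇ H U ≡ resolvesᵇ H′ U
  resolvesᵇ-resp {H} {H′} H≈H′ U = T-⇔⇒≡ (mk⇔ (from (T-resolvesᵇ H′ U) ∘ Resolves-mono (to H≈H′) ∘ to (T-resolvesᵇ H U))
                                                (from (T-resolvesᵇ H U) ∘ Resolves-mono (from H≈H′) ∘ to (T-resolvesᵇ H′ U)))

  agreeᵇ-resp : {H H′ : Clusters n} (G : Clusters n) → H ≈ᶜ H′ → (U : Subset n) → agreeᵇ H G U ≡ agreeᵇ H′ G U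
  agreeᵇ-resp {H} {H′} G H≈H′ U = T-⇔⇒≡ (mk⇔ (from (T-agreeᵇ H′ G U) ∘ move (to H≈H′) ∘ to (T-agreeᵇ H G U))
                                               (from (T-agreeᵇ H G U) ∘ move (from H≈H′) ∘ to (T-agreeᵇ H′ G U)))
    where
    move : {G₁ G₂ : Clusters n} → (∀ {C} → C ∈ G₁ → C ∈ G₂) → Agree G₁ G U → Agree G₂ G U
    move G₁⊆G₂ (K , K∈ , cut , m) = K , G₁⊆G₂ K∈ , cut , m

  canonical : Clusters n → Clusters n
  canonical H = filter (T? ∘ (_∈ᶜ H)) (subsets n)

  canonical≈ : (H : Clusters n) → canonical H ≈ᶜ H
  canonical≈ H {C} = mk⇔ (to T-∈ᶜ ∘ proj₂ ∘ ∈-filter⁻ (T? ∘ (_∈ᶜ H)) {xs = subsets n})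
                         (∈-filter⁺ (T? ∘ (_∈ᶜ H)) (∈-subsets C) ∘ from T-∈ᶜ)

  canonical∈𝓕 : {T₀ t : Clusters n} → IsHierarchy t → T (isFullyResolved t) → (∀ {C} → C ∈ T₀ → C ∈ t) →
                canonical t ∈ 𝓕 T₀
  canonical∈𝓕 {T₀} {t} ht fr T₀⊆t =
    ∈-filter⁺ (λ H′ → T? (isHierarchy H′ ∧ isFullyResolved H′ ∧ refines H′ T₀)) (filter∈sublists (_∈ᶜ t) (subsets n))
      (from (T-∧ {isHierarchy (canonical t)})
        ( from T-isHierarchy (IsHierarchy-resp (mk⇔ (from (canonical≈ t)) (to (canonical≈ t))) ht)
        , from (T-∧ {isFullyResolved (canonical t)})
            ( subst T (sym (isFullyResolved-resp (canonical≈ t))) fr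
            , from T-refines (from (canonical≈ t) ∘ T₀⊆t))))

  ∈𝓕⇒ : {T₀ t : Clusters n} → t ∈ 𝓕 T₀ → IsHierarchy t × (∀ {C} → C ∈ T₀ → C ∈ t)
  ∈𝓕⇒ {T₀} {t} t∈ =
    let h = proj₂ (∈-filter⁻ (λ H′ → T? (isHierarchy H′ ∧ isFullyResolved H′ ∧ refines H′ T₀)) {xs = sublists (subsets n)} t∈)
        (hier , h′) = to (T-∧ {isHierarchy t}) h
    in to T-isHierarchy hier , to T-refines (proj₂ (to (T-∧ {isFullyResolved t}) h′))

dHausWith-comm : {n : ℕ} (d : Clusters n → Clusters n → ℕ) (T₁ T₂ : Clusters n) →
                 dHausWith d T₁ T₂ ≡ dHausWith (flip d) T₂ T₁
dHausWith-comm d T₁ T₂ =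
  ⊔-comm (maxList (map (λ t₁ → minList (map (λ t₂ → d t₁ t₂) (𝓕 T₂))) (𝓕 T₁)))
         (maxList (map (λ t₂ → minList (map (λ t₁ → d t₁ t₂) (𝓕 T₁))) (𝓕 T₂)))

dHausWith-cong : {n : ℕ} {d d′ : Clusters n → Clusters n → ℕ} → (∀ t₁ t₂ → d t₁ t₂ ≡ d′ t₁ t₂) →
                 (T₁ T₂ : Clusters n) → dHausWith d T₁ T₂ ≡ dHausWith d′ T₁ T₂
dHausWith-cong d≗d′ T₁ T₂ = cong₂ _⊔_
  (cong maxList (map-cong (λ t₁ → cong minList (map-cong (λ t₂ → d≗d′ t₁ t₂) (𝓕 T₂))) (𝓕 T₁)))
  (cong maxList (map-cong (λ t₂ → cong minList (map-cong (λ t₁ → d≗d′ t₁ t₂) (𝓕 T₁))) (𝓕 T₂)))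

≤-dHausWith : {n : ℕ} (d : Clusters n → Clusters n → ℕ) {T₁ T₂ t₁ t₂ : Clusters n} (k : ℕ) {v : ℕ} →
              t₁ ∈ 𝓕 T₁ → t₂ ∈ 𝓕 T₂ → (∀ {t} → t ∈ 𝓕 T₂ → v ≤ k * d t₁ t) → v ≤ k * dHausWith d T₁ T₂
≤-dHausWith d {T₁} {T₂} {t₁} k {v} t₁∈ t₂∈ bound with minList-attained (d t₁) t₂∈
... | t , t∈ , min≡ = begin
  v                                                              ≤⟨ bound t∈ ⟩
  k * d t₁ t                                                     ≡⟨ cong (k *_) min≡ ⟨
  k * minList (map (d t₁) (𝓕 T₂))                               ≤⟨ *-monoʳ-≤ k (≤-maxList (λ t₁ → minList (map (d t₁) (𝓕 T₂))) t₁∈) ⟩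
  k * maxList (map (λ t₁ → minList (map (d t₁) (𝓕 T₂))) (𝓕 T₁)) ≤⟨ *-monoʳ-≤ k (m≤m⊔n _ _) ⟩
  k * dHausWith d T₁ T₂                                          ∎
  where open ≤-Reasoning

module _ {n : ℕ} (P : Subset n → Bool) (P⇒unit : ∀ U → T (P U) → IsUnit U) where

  disagreeᵇ onlyInᵇ : Clusters n → Clusters n → Subset n → Bool
  disagreeᵇ H₁ H₂ U = P U ∧ resolvesᵇ H₁ U ∧ resolvesᵇ H₂ U ∧ not (agreeᵇ H₁ H₂ U)
  onlyInᵇ H₁ H₂ U = P U ∧ resolvesᵇ H₁ U ∧ not (resolvesᵇ H₂ U)

  #Disagree #OnlyIn : Clusters n → Clusters n → ℕ
  #Disagree H₁ H₂ = countSubsets (disagreeᵇ H₁ H₂)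
  #OnlyIn H₁ H₂ = countSubsets (onlyInᵇ H₁ H₂)

  T-disagreeᵇ : (H₁ H₂ : Clusters n) (U : Subset n) →
                T (disagreeᵇ H₁ H₂ U) ⇔ (T (P U) × Resolves H₁ U × Resolves H₂ U × ¬ Agree H₁ H₂ U)
  T-disagreeᵇ H₁ H₂ U = mk⇔
    (λ h → let (p , h₁) = to (T-∧ {P U}) h ; (r₁ , h₂) = to (T-∧ {resolvesᵇ H₁ U}) h₁
               (r₂ , ¬a) = to (T-∧ {resolvesᵇ H₂ U}) h₂
           in p , to (T-resolvesᵇ H₁ U) r₁ , to (T-resolvesᵇ H₂ U) r₂ , to T-not ¬a ∘ from (T-agreeᵇ H₁ H₂ U))
    (λ (p , r₁ , r₂ , ¬a) → from (T-∧ {P U}) (p , from (T-∧ {resolvesᵇ H₁ U}) (from (T-resolvesᵇ H₁ U) r₁ ,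
                              from (T-∧ {resolvesᵇ H₂ U}) (from (T-resolvesᵇ H₂ U) r₂ , from T-not (¬a ∘ to (T-agreeᵇ H₁ H₂ U))))))

  #Disagree-sym : (H₁ H₂ : Clusters n) → #Disagree H₁ H₂ ≡ #Disagree H₂ H₁
  #Disagree-sym H₁ H₂ =
    trans (length-filter≡∑𝟙 (disagreeᵇ H₁ H₂) (subsets n))
          (trans (∑-cong (subsets n) (λ U _ → cong 𝟙 (T-⇔⇒≡ (mk⇔ (swap H₁ H₂ U) (swap H₂ H₁ U)))))
                 (sym (length-filter≡∑𝟙 (disagreeᵇ H₂ H₁) (subsets n))))
    where
    swap : ∀ G₁ G₂ U → T (disagreeᵇ G₁ G₂ U) → T (disagreeᵇ G₂ G₁ U)
    swap G₁ G₂ U d = let (p , r₁ , r₂ , ¬a) = to (T-disagreeᵇ G₁ G₂ U) d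
                     in from (T-disagreeᵇ G₂ G₁ U) (p , r₂ , r₁ , ¬a ∘ Agree-sym)

  #Disagree-resp : {H H′ : Clusters n} → H ≈ᶜ H′ → (G : Clusters n) → #Disagree H G ≡ #Disagree H′ G
  #Disagree-resp {H} {H′} H≈H′ G =
    trans (length-filter≡∑𝟙 (disagreeᵇ H G) (subsets n))
          (trans (∑-cong (subsets n) (λ U _ → cong₂ (λ r a → 𝟙 (P U ∧ r ∧ resolvesᵇ G U ∧ not a))
                                                     (resolvesᵇ-resp H≈H′ U) (agreeᵇ-resp G H≈H′ U)))
                 (sym (length-filter≡∑𝟙 (disagreeᵇ H′ G) (subsets n))))

  disagreement-grows : {T₁ T₂ t b : Clusters n} → IsHierarchy T₁ → IsHierarchy T₂ → IsHierarchy t → IsHierarchy b →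
                       (∀ {C} → C ∈ T₁ → C ∈ t) → (∀ {C} → C ∈ T₂ → C ∈ b) → (U : Subset n) →
                       𝟙 (disagreeᵇ T₁ T₂ U) + 𝟙 (onlyInᵇ T₂ T₁ U ∧ resolvesᵇ t U ∧ not (agreeᵇ t T₂ U)) ≤ 𝟙 (disagreeᵇ t b U)
  disagreement-grows {T₁} {T₂} {t} {b} hT₁ hT₂ ht hb T₁⊆t T₂⊆b U = 𝟙-exclusive-≤ exclusive old new
    where
    exclusive : T (disagreeᵇ T₁ T₂ U) → ¬ T (onlyInᵇ T₂ T₁ U ∧ resolvesᵇ t U ∧ not (agreeᵇ t T₂ U))
    exclusive d c = let (_ , r₁ , _) = to (T-disagreeᵇ T₁ T₂ U) d
                        (only , _) = to (T-∧ {onlyInᵇ T₂ T₁ U}) c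
                        (_ , only′) = to (T-∧ {P U}) only
                    in to T-not (proj₂ (to (T-∧ {resolvesᵇ T₂ U}) only′)) (from (T-resolvesᵇ T₁ U) r₁)
    old : T (disagreeᵇ T₁ T₂ U) → T (disagreeᵇ t b U)
    old d with to (T-disagreeᵇ T₁ T₂ U) d
    ... | p , (K , K∈ , cutK) , (B , B∈ , cutB) , ¬agree =
      from (T-disagreeᵇ t b U) (p , (K , T₁⊆t K∈ , cutK) , (B , T₂⊆b B∈ , cutB) ,
        λ agree → ¬agree (K , K∈ , cutK , B , B∈ , cutB , Agree-unique ht hb (P⇒unit U p) (T₁⊆t K∈) cutK (T₂⊆b B∈) cutB agree))
    new : T (onlyInᵇ T₂ T₁ U ∧ resolvesᵇ t U ∧ not (agreeᵇ t T₂ U)) → T (disagreeᵇ t b U)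
    new c = let (only , c′) = to (T-∧ {onlyInᵇ T₂ T₁ U}) c
                (p , only′) = to (T-∧ {P U}) only
                (B , B∈ , cutB) = to (T-resolvesᵇ T₂ U) (proj₁ (to (T-∧ {resolvesᵇ T₂ U}) only′))
                (rt , ¬a) = to (T-∧ {resolvesᵇ t U}) c′
                (K , K∈ , cutK) = to (T-resolvesᵇ t U) rt
            in from (T-disagreeᵇ t b U) (p , (K , K∈ , cutK) , (B , T₂⊆b B∈ , cutB) ,
                 λ agree → to T-not ¬a (from (T-agreeᵇ t T₂ U)
                   (K , K∈ , cutK , B , B∈ , cutB , Agree-unique ht hb (P⇒unit U p) K∈ cutK (T₂⊆b B∈) cutB agree)))

  refinement-bound : {T₁ T₂ : Clusters n} → IsHierarchy T₁ → IsHierarchy T₂ →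
                     ∃ λ t₁ → t₁ ∈ 𝓕 T₁ × (∀ {t₂} → t₂ ∈ 𝓕 T₂ → 3 * #Disagree T₁ T₂ + 2 * #OnlyIn T₂ T₁ ≤ 3 * #Disagree t₁ t₂)
  refinement-bound {T₁} {T₂} hT₁ hT₂ =
    let (t , ht , fr , T₁⊆t , balanced) = balanced-refinement hT₁
    in canonical t , canonical∈𝓕 ht fr T₁⊆t , bound t ht fr T₁⊆t balanced
    where
    open Refinement P P⇒unit T₁ T₂ hT₂
    bound : ∀ t → IsHierarchy t → T (isFullyResolved t) → (∀ {C} → C ∈ T₁ → C ∈ t) → Balanced t →
            ∀ {b} → b ∈ 𝓕 T₂ → 3 * #Disagree T₁ T₂ + 2 * #OnlyIn T₂ T₁ ≤ 3 * #Disagree (canonical t) b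
    bound t ht fr T₁⊆t balanced {b} b∈ = begin
      3 * #Disagree T₁ T₂ + 2 * #OnlyIn T₂ T₁          ≡⟨ cong (λ r → 3 * #Disagree T₁ T₂ + 2 * r) #OnlyIn≡#resolved ⟩
      3 * #Disagree T₁ T₂ + 2 * #resolved t            ≤⟨ +-monoʳ-≤ (3 * #Disagree T₁ T₂) balanced ⟩
      3 * #Disagree T₁ T₂ + 3 * #conflicting t         ≡⟨ *-distribˡ-+ 3 (#Disagree T₁ T₂) (#conflicting t) ⟨
      3 * (#Disagree T₁ T₂ + #conflicting t)           ≤⟨ *-monoʳ-≤ 3 grows ⟩
      3 * #Disagree t b                                ≡⟨ cong (3 *_) (#Disagree-resp (canonical≈ t) b) ⟨
      3 * #Disagree (canonical t) b                    ∎
      where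
      open ≤-Reasoning
      hb : IsHierarchy b
      hb = proj₁ (∈𝓕⇒ {T₀ = T₂} b∈)
      T₂⊆b : ∀ {C} → C ∈ T₂ → C ∈ b
      T₂⊆b = proj₂ (∈𝓕⇒ {T₀ = T₂} b∈)
      #OnlyIn≡#resolved : #OnlyIn T₂ T₁ ≡ #resolved t
      #OnlyIn≡#resolved = trans (length-filter≡∑𝟙 onlyT₂ (subsets n)) (sym (#resolved-fullyResolved ht fr))
      grows : #Disagree T₁ T₂ + #conflicting t ≤ #Disagree t b
      grows = begin
        #Disagree T₁ T₂ + #conflicting t
          ≡⟨ cong (_+ #conflicting t) (length-filter≡∑𝟙 (disagreeᵇ T₁ T₂) (subsets n)) ⟩
        ∑ (subsets n) (𝟙 ∘ disagreeᵇ T₁ T₂) + #conflicting t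
          ≡⟨ ∑-+ (subsets n) _ _ ⟨
        ∑ (subsets n) (λ U → 𝟙 (disagreeᵇ T₁ T₂ U) + 𝟙 (onlyT₂ U ∧ resolvesᵇ t U ∧ not (agreeᵇ t T₂ U)))
          ≤⟨ ∑-mono (subsets n) (λ U _ → disagreement-grows hT₁ hT₂ ht hb T₁⊆t T₂⊆b U) ⟩
        ∑ (subsets n) (𝟙 ∘ disagreeᵇ t b)
          ≡⟨ length-filter≡∑𝟙 (disagreeᵇ t b) (subsets n) ⟨
        #Disagree t b
          ∎

  hausdorff-bound : {T₁ T₂ : Clusters n} → IsHierarchy T₁ → IsHierarchy T₂ →
                    3 * #Disagree T₁ T₂ + 2 * (#OnlyIn T₁ T₂ ⊔ #OnlyIn T₂ T₁) ≤ 3 * dHausWith #Disagree T₁ T₂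
  hausdorff-bound {T₁} {T₂} hT₁ hT₂ = begin
    3 * #Disagree T₁ T₂ + 2 * (#OnlyIn T₁ T₂ ⊔ #OnlyIn T₂ T₁)
      ≡⟨ cong (3 * #Disagree T₁ T₂ +_) (*-distribˡ-⊔ 2 (#OnlyIn T₁ T₂) (#OnlyIn T₂ T₁)) ⟩
    3 * #Disagree T₁ T₂ + (2 * #OnlyIn T₁ T₂ ⊔ 2 * #OnlyIn T₂ T₁)
      ≡⟨ +-distribˡ-⊔ (3 * #Disagree T₁ T₂) _ _ ⟩
    (3 * #Disagree T₁ T₂ + 2 * #OnlyIn T₁ T₂) ⊔ (3 * #Disagree T₁ T₂ + 2 * #OnlyIn T₂ T₁)
      ≤⟨ ⊔-lub from-T₂-side from-T₁-side ⟩
    3 * dHausWith #Disagree T₁ T₂ ∎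
    where
    open ≤-Reasoning
    side₁ : ∃ λ t₁ → t₁ ∈ 𝓕 T₁ × (∀ {t₂} → t₂ ∈ 𝓕 T₂ → 3 * #Disagree T₁ T₂ + 2 * #OnlyIn T₂ T₁ ≤ 3 * #Disagree t₁ t₂)
    side₁ = refinement-bound hT₁ hT₂
    side₂ : ∃ λ t₂ → t₂ ∈ 𝓕 T₂ × (∀ {t₁} → t₁ ∈ 𝓕 T₁ → 3 * #Disagree T₂ T₁ + 2 * #OnlyIn T₁ T₂ ≤ 3 * #Disagree t₂ t₁)
    side₂ = refinement-bound hT₂ hT₁
    from-T₁-side : 3 * #Disagree T₁ T₂ + 2 * #OnlyIn T₂ T₁ ≤ 3 * dHausWith #Disagree T₁ T₂
    from-T₁-side = ≤-dHausWith #Disagree {T₁} {T₂} 3 (proj₁ (proj₂ side₁)) (proj₁ (proj₂ side₂)) (proj₂ (proj₂ side₁))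
    from-T₂-side : 3 * #Disagree T₁ T₂ + 2 * #OnlyIn T₁ T₂ ≤ 3 * dHausWith #Disagree T₁ T₂
    from-T₂-side = begin
      3 * #Disagree T₁ T₂ + 2 * #OnlyIn T₁ T₂
        ≡⟨ cong (λ d → 3 * d + 2 * #OnlyIn T₁ T₂) (#Disagree-sym T₁ T₂) ⟩
      3 * #Disagree T₂ T₁ + 2 * #OnlyIn T₁ T₂
        ≤⟨ ≤-dHausWith (flip #Disagree) {T₂} {T₁} 3 (proj₁ (proj₂ side₂)) (proj₁ (proj₂ side₁)) flipped ⟩
      3 * dHausWith (flip #Disagree) T₂ T₁
        ≡⟨ cong (3 *_) (dHausWith-comm #Disagree T₁ T₂) ⟨
      3 * dHausWith #Disagree T₁ T₂
        ∎
      where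
      flipped : ∀ {t} → t ∈ 𝓕 T₁ → 3 * #Disagree T₂ T₁ + 2 * #OnlyIn T₁ T₂ ≤ 3 * #Disagree t (proj₁ side₂)
      flipped {t} t∈ = subst (λ d → 3 * #Disagree T₂ T₁ + 2 * #OnlyIn T₁ T₂ ≤ 3 * d)
                             (#Disagree-sym (proj₁ side₂) t) (proj₂ (proj₂ side₂) t∈)

hausdorff-bound-transfer : {n : ℕ} (P : Subset n → Bool) (P⇒unit : ∀ U → T (P U) → IsUnit U)
                           (D R : Clusters n → Clusters n → ℕ) →
                           (∀ H₁ H₂ → D H₁ H₂ ≡ #Disagree P P⇒unit H₁ H₂) → (∀ H₁ H₂ → R H₁ H₂ ≡ #OnlyIn P P⇒unit H₁ H₂) →
                           (T₁ T₂ : Clusters n) → isHierarchy T₁ ≡ true → isHierarchy T₂ ≡ true →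
                           3 * dHausWith D T₁ T₂ ≥ 3 * D T₁ T₂ + 2 * (R T₁ T₂ ⊔ R T₂ T₁)
hausdorff-bound-transfer P P⇒unit D R D≡ R≡ T₁ T₂ h₁ h₂ =
  subst₂ _≤_ (sym (cong₂ (λ d r → 3 * d + 2 * r) (D≡ T₁ T₂) (cong₂ _⊔_ (R≡ T₁ T₂) (R≡ T₂ T₁))))
             (sym (cong (3 *_) (dHausWith-cong D≡ T₁ T₂)))
             (hausdorff-bound P P⇒unit (≡true⇒IsHierarchy T₁ h₁) (≡true⇒IsHierarchy T₂ h₂))

module _ {n : ℕ} where

  T-anyPair : (X : Subset n) {p : Subset n → Bool} →
              T (any p (pairsOf X)) ⇔ (∃ λ Y → Y ⊆ X × ∣ Y ∣ ≡ 2 × T (p Y))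
  T-anyPair X {p} = mk⇔ ⇒ ⇐
    where
    isPair : Subset n → Bool
    isPair Y = (Y ⊆ᵇ X) ∧ ofSize 2 Y
    ⇒ : T (any p (pairsOf X)) → ∃ λ Y → Y ⊆ X × ∣ Y ∣ ≡ 2 × T (p Y)
    ⇒ h = let (Y , Y∈ , pY) = find (any⁻ p (pairsOf X) h)
              (Y⊆X , 2≡) = to (T-∧ {Y ⊆ᵇ X}) (proj₂ (∈-filter⁻ (T? ∘ isPair) {xs = subsets n} Y∈))
          in Y , to T-⊆ᵇ Y⊆X , ≡ᵇ⇒≡ ∣ Y ∣ 2 2≡ , pY
    ⇐ : (∃ λ Y → Y ⊆ X × ∣ Y ∣ ≡ 2 × T (p Y)) → T (any p (pairsOf X))
    ⇐ (Y , Y⊆X , ∣Y∣≡2 , pY) =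
      any⁺ p (Any.map (λ { refl → pY })
                (∈-filter⁺ (T? ∘ isPair) (∈-subsets Y) (from (T-∧ {Y ⊆ᵇ X}) (from T-⊆ᵇ Y⊆X , ≡⇒≡ᵇ ∣ Y ∣ 2 ∣Y∣≡2))))

module TripletCounts {n : ℕ} where
  open Triplet {n}

  T-cherry : (H : Clusters n) (X Y : Subset n) → T (cherry H X Y) ⇔ (∃ λ C → C ∈ H × C ∩ X ≡ Y)
  T-cherry H X Y = mk⇔
    (λ h → let (C , t) = to (T-anySubset {p = λ C → (C ∈ᶜ H) ∧ ((C ∩ X) == Y)}) h ; (C∈H , e) = to (T-∧ {C ∈ᶜ H}) t
           in C , to T-∈ᶜ C∈H , to T-== e)
    (λ (C , C∈H , e) → from (T-anySubset {p = λ C → (C ∈ᶜ H) ∧ ((C ∩ X) == Y)}) (C , from (T-∧ {C ∈ᶜ H}) (from T-∈ᶜ C∈H , from T-== e)))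

  T-resolved : (H : Clusters n) (X : Subset n) → T (resolved H X) ⇔ Resolves H X
  T-resolved H X = mk⇔
    (λ h → let (Y , _ , ∣Y∣≡2 , ch) = to (T-anyPair X) h ; (C , C∈H , C∩X≡Y) = to (T-cherry H X Y) ch
           in C , C∈H , trans (cong ∣_∣ C∩X≡Y) ∣Y∣≡2)
    (λ (C , C∈H , cut) → from (T-anyPair X) (C ∩ X , p∩q⊆q C X , cut , from (T-cherry H X (C ∩ X)) (C , C∈H , refl)))

  T-sameRestriction : (H₁ H₂ : Clusters n) (X : Subset n) → ∣ X ∣ ≡ 3 → T (sameRestriction H₁ H₂ X) ⇔ Agree H₁ H₂ X
  T-sameRestriction H₁ H₂ X ∣X∣≡3 = mk⇔ ⇒ ⇐
    where
    ⇒ : T (sameRestriction H₁ H₂ X) → Agree H₁ H₂ X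
    ⇒ h = let (Y , _ , ∣Y∣≡2 , both) = to (T-anyPair X) h ; (ch₁ , ch₂) = to (T-∧ {cherry H₁ X Y}) both
              (C₁ , C₁∈ , e₁) = to (T-cherry H₁ X Y) ch₁ ; (C₂ , C₂∈ , e₂) = to (T-cherry H₂ X Y) ch₂
          in C₁ , C₁∈ , trans (cong ∣_∣ e₁) ∣Y∣≡2 , C₂ , C₂∈ , trans (cong ∣_∣ e₂) ∣Y∣≡2 , inj₁ (trans e₁ (sym e₂))
    ⇐ : Agree H₁ H₂ X → T (sameRestriction H₁ H₂ X)
    ⇐ (C₁ , C₁∈ , cut₁ , C₂ , C₂∈ , cut₂ , inj₁ e) =
      from (T-anyPair X) (C₁ ∩ X , p∩q⊆q C₁ X , cut₁ ,
        from (T-∧ {cherry H₁ X (C₁ ∩ X)}) (from (T-cherry H₁ X _) (C₁ , C₁∈ , refl) , from (T-cherry H₂ X _) (C₂ , C₂∈ , sym e)))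
    ⇐ (C₁ , C₁∈ , cut₁ , C₂ , C₂∈ , cut₂ , inj₂ e) = ⊥-elim (3≢4 (begin
      3                         ≡⟨ ∣X∣≡3 ⟨
      ∣ X ∣                     ≡⟨ ∣X∣≡∣Y∣+∣X∖Y∣ (p∩q⊆q C₂ X) ⟩
      ∣ C₂ ∩ X ∣ + ∣ X ∩ ∁ (C₂ ∩ X) ∣ ≡⟨ cong₂ (λ k Z → k + ∣ Z ∣) cut₂ (identity (x₀ ∩ᶠ ∁ᶠ (x₁ ∩ᶠ x₀) ≐ x₀ ∩ᶠ ∁ᶠ x₁) _ (X ∷ C₂ ∷ [])) ⟩
      2 + ∣ X ∩ ∁ C₂ ∣          ≡⟨ cong (λ Z → 2 + ∣ Z ∣) e ⟨
      2 + ∣ C₁ ∩ X ∣            ≡⟨ cong (2 +_) cut₁ ⟩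
      4                         ∎))
      where
      open ≡-Reasoning
      3≢4 : 3 ≢ 4
      3≢4 ()

  P₃ : Subset n → Bool
  P₃ U = ofSize 3 U

  P₃⇒unit : ∀ U → T (P₃ U) → IsUnit U
  P₃⇒unit U = inj₁ ∘ ≡ᵇ⇒≡ ∣ U ∣ 3

  resolved≡ : (H : Clusters n) (X : Subset n) → resolved H X ≡ resolvesᵇ H X
  resolved≡ H X = ⇔-same⇒≡ (T-resolved H X) (T-resolvesᵇ H X)

  #D≡ : (H₁ H₂ : Clusters n) → #D H₁ H₂ ≡ #Disagree P₃ P₃⇒unit H₁ H₂
  #D≡ H₁ H₂ = countSubsets-cong pointwise
    where
    pointwise : ∀ X → (ofSize 3 X ∧ resolved H₁ X ∧ resolved H₂ X ∧ not (sameRestriction H₁ H₂ X)) ≡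
                      disagreeᵇ P₃ P₃⇒unit H₁ H₂ X
    pointwise X with T? (ofSize 3 X)
    ... | no ¬3 = ¬T⇒∧≡∧ _ _ ¬3
    ... | yes is3 = trans (cong₂ (λ r₁ r₂ → ofSize 3 X ∧ r₁ ∧ r₂ ∧ not (sameRestriction H₁ H₂ X)) (resolved≡ H₁ X) (resolved≡ H₂ X))
                          (cong (λ s → ofSize 3 X ∧ resolvesᵇ H₁ X ∧ resolvesᵇ H₂ X ∧ not s)
                            (⇔-same⇒≡ (T-sameRestriction H₁ H₂ X ∣X∣≡3) (T-agreeᵇ H₁ H₂ X)))
      where
      ∣X∣≡3 : ∣ X ∣ ≡ 3
      ∣X∣≡3 = ≡ᵇ⇒≡ ∣ X ∣ 3 is3

  #R₁≡ : (H₁ H₂ : Clusters n) → #R₁ H₁ H₂ ≡ #OnlyIn P₃ P₃⇒unit H₁ H₂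
  #R₁≡ H₁ H₂ = countSubsets-cong (λ X → cong₂ (λ r s → ofSize 3 X ∧ r ∧ not s) (resolved≡ H₁ X) (resolved≡ H₂ X))

module QuartetCounts {n : ℕ} where
  open Quartet {n}

  T-split : (H : Clusters n) (Q Y : Subset (suc n)) →
            T (split H Q Y) ⇔ (∃ λ C → C ∈ H × (lift C ∩ Q ≡ Y ⊎ lift C ∩ Q ≡ Q ∩ ∁ Y))
  T-split H Q Y = mk⇔
    (λ h → let (C , t) = to (T-anySubset {p = splitBy}) h ; (C∈H , e) = to (T-∧ {C ∈ᶜ H}) t
           in C , to T-∈ᶜ C∈H , Sum.map (to T-==) (to T-==) (to (T-∨ {(lift C ∩ Q) == Y}) e))
    (λ (C , C∈H , e) → from (T-anySubset {p = splitBy})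
      (C , from (T-∧ {C ∈ᶜ H}) (from T-∈ᶜ C∈H , from (T-∨ {(lift C ∩ Q) == Y}) (Sum.map (from T-==) (from T-==) e))))
    where
    splitBy : Subset n → Bool
    splitBy C = (C ∈ᶜ H) ∧ (((lift C ∩ Q) == Y) ∨ ((lift C ∩ Q) == (Q ∩ ∁ Y)))

  private
    -- lift C ∩ (b ∷ U) is false ∷ (C ∩ U), so its size is ∣ C ∩ U ∣
    split⇒cut : {b : Bool} {U : Subset n} {Y : Subset (suc n)} {C : Subset n} → ∣ b ∷ U ∣ ≡ 4 → Y ⊆ b ∷ U → ∣ Y ∣ ≡ 2 →
                lift C ∩ (b ∷ U) ≡ Y ⊎ lift C ∩ (b ∷ U) ≡ (b ∷ U) ∩ ∁ Y → ∣ C ∩ U ∣ ≡ 2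
    split⇒cut _ _ ∣Y∣≡2 (inj₁ e) = trans (cong ∣_∣ e) ∣Y∣≡2
    split⇒cut {b} {U} {Y} ∣Q∣≡4 Y⊆Q ∣Y∣≡2 (inj₂ e) =
      trans (cong ∣_∣ e) (+-cancelˡ-≡ 2 _ _ (trans (cong (_+ ∣ (b ∷ U) ∩ ∁ Y ∣) (sym ∣Y∣≡2)) (trans (sym (∣X∣≡∣Y∣+∣X∖Y∣ Y⊆Q)) ∣Q∣≡4)))

  T-resolved : (H : Clusters n) (b : Bool) (U : Subset n) → ∣ b ∷ U ∣ ≡ 4 → T (resolved H (b ∷ U)) ⇔ Resolves H U
  T-resolved H b U ∣Q∣≡4 = mk⇔
    (λ h → let (Y , Y⊆Q , ∣Y∣≡2 , s) = to (T-anyPair (b ∷ U)) h ; (C , C∈H , e) = to (T-split H (b ∷ U) Y) s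
           in C , C∈H , split⇒cut ∣Q∣≡4 Y⊆Q ∣Y∣≡2 e)
    (λ (C , C∈H , cut) → from (T-anyPair (b ∷ U))
      (lift C ∩ (b ∷ U) , p∩q⊆q (lift C) (b ∷ U) , cut , from (T-split H (b ∷ U) _) (C , C∈H , inj₁ refl)))

  T-sameRestriction : (H₁ H₂ : Clusters n) (b : Bool) (U : Subset n) → ∣ b ∷ U ∣ ≡ 4 →
                      T (sameRestriction H₁ H₂ (b ∷ U)) ⇔ Agree H₁ H₂ U
  T-sameRestriction H₁ H₂ b U ∣Q∣≡4 = mk⇔ ⇒ (⇐ b ∣Q∣≡4)
    where
    ⇒ : T (sameRestriction H₁ H₂ (b ∷ U)) → Agree H₁ H₂ U
    ⇒ h = let (Y , Y⊆Q , ∣Y∣≡2 , both) = to (T-anyPair (b ∷ U)) h ; (s₁ , s₂) = to (T-∧ {split H₁ (b ∷ U) Y}) both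
              (C₁ , C₁∈ , e₁) = to (T-split H₁ (b ∷ U) Y) s₁ ; (C₂ , C₂∈ , e₂) = to (T-split H₂ (b ∷ U) Y) s₂
          in C₁ , C₁∈ , split⇒cut ∣Q∣≡4 Y⊆Q ∣Y∣≡2 e₁ , C₂ , C₂∈ , split⇒cut ∣Q∣≡4 Y⊆Q ∣Y∣≡2 e₂ , same e₁ e₂
      where
      flipped : {C C′ : Subset n} → C′ ∩ U ≡ U ∩ ∁ (C ∩ U) → SameSplit U C C′
      flipped {C} {C′} e = inj₂ (tautology-lift (x₁ ∩ᶠ x₂ ≐ x₂ ∩ᶠ ∁ᶠ (x₀ ∩ᶠ x₂) ∷ []) (x₀ ∩ᶠ x₂ ≐ x₂ ∩ᶠ ∁ᶠ x₁) _
                                                (C ∷ C′ ∷ U ∷ []) (e ∷ []))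
      same : ∀ {Y C₁ C₂} → lift C₁ ∩ (b ∷ U) ≡ Y ⊎ lift C₁ ∩ (b ∷ U) ≡ (b ∷ U) ∩ ∁ Y →
             lift C₂ ∩ (b ∷ U) ≡ Y ⊎ lift C₂ ∩ (b ∷ U) ≡ (b ∷ U) ∩ ∁ Y → SameSplit U C₁ C₂
      same (inj₁ e₁) (inj₁ e₂) = inj₁ (∷-injectiveʳ (trans e₁ (sym e₂)))
      same (inj₂ e₁) (inj₂ e₂) = inj₁ (∷-injectiveʳ (trans e₁ (sym e₂)))
      same (inj₁ refl) (inj₂ e₂) = flipped (∷-injectiveʳ e₂)
      same (inj₂ e₁) (inj₁ refl) = SameSplit-sym (flipped (∷-injectiveʳ e₁))
    ⇐ : (b′ : Bool) → ∣ b′ ∷ U ∣ ≡ 4 → Agree H₁ H₂ U → T (sameRestriction H₁ H₂ (b′ ∷ U))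
    ⇐ b′ ∣Q′∣≡4 (C₁ , C₁∈ , cut₁ , C₂ , C₂∈ , cut₂ , same) =
      from (T-anyPair (b′ ∷ U)) (lift C₁ ∩ (b′ ∷ U) , p∩q⊆q (lift C₁) (b′ ∷ U) , cut₁ ,
        from (T-∧ {split H₁ (b′ ∷ U) (lift C₁ ∩ (b′ ∷ U))})
          (from (T-split H₁ (b′ ∷ U) _) (C₁ , C₁∈ , inj₁ refl) , from (T-split H₂ (b′ ∷ U) _) (C₂ , C₂∈ , second b′ ∣Q′∣≡4 same)))
      where
      second : (b″ : Bool) → ∣ b″ ∷ U ∣ ≡ 4 → SameSplit U C₁ C₂ →
               lift C₂ ∩ (b″ ∷ U) ≡ lift C₁ ∩ (b″ ∷ U) ⊎ lift C₂ ∩ (b″ ∷ U) ≡ (b″ ∷ U) ∩ ∁ (lift C₁ ∩ (b″ ∷ U))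
      second _ _ (inj₁ e) = inj₁ (cong (false ∷_) (sym e))
      second false _ (inj₂ e) = inj₂ (cong (false ∷_) (tautology-lift (x₀ ∩ᶠ x₂ ≐ x₂ ∩ᶠ ∁ᶠ x₁ ∷ []) (x₁ ∩ᶠ x₂ ≐ x₂ ∩ᶠ ∁ᶠ (x₀ ∩ᶠ x₂)) _
                                                     (C₁ ∷ C₂ ∷ U ∷ []) (e ∷ [])))
      second true ∣U∣+1≡4 (inj₂ e) = ⊥-elim (3≢4 (begin
        3                          ≡⟨ suc-injective ∣U∣+1≡4 ⟨
        ∣ U ∣                      ≡⟨ ∣X∣≡∣Y∣+∣X∖Y∣ (p∩q⊆q C₂ U) ⟩
        ∣ C₂ ∩ U ∣ + ∣ U ∩ ∁ (C₂ ∩ U) ∣ ≡⟨ cong₂ (λ k Z → k + ∣ Z ∣) cut₂ (identity (x₀ ∩ᶠ ∁ᶠ (x₁ ∩ᶠ x₀) ≐ x₀ ∩ᶠ ∁ᶠ x₁) _ (U ∷ C₂ ∷ [])) ⟩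
        2 + ∣ U ∩ ∁ C₂ ∣           ≡⟨ cong (λ Z → 2 + ∣ Z ∣) e ⟨
        2 + ∣ C₁ ∩ U ∣             ≡⟨ cong (2 +_) cut₁ ⟩
        4                          ∎))
        where
        open ≡-Reasoning
        3≢4 : 3 ≢ 4
        3≢4 ()

  P₃₄ : Subset n → Bool
  P₃₄ U = (∣ U ∣ ≡ᵇ 3) ∨ (∣ U ∣ ≡ᵇ 4)

  P₃₄⇒unit : ∀ U → T (P₃₄ U) → IsUnit U
  P₃₄⇒unit U = Sum.map (≡ᵇ⇒≡ ∣ U ∣ 3) (≡ᵇ⇒≡ ∣ U ∣ 4) ∘ to (T-∨ {∣ U ∣ ≡ᵇ 3})

  private
    -- a quartet b ∷ U of Fin (suc n) has 4 taxa iff U has 4 (b = false) or 3 (b = true)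
    by-size : ∀ x₃ x₄ a b c → (T x₄ → ¬ T x₃) → (T x₄ → a ≡ c) → (T x₃ → b ≡ c) →
              𝟙 (x₄ ∧ a) + 𝟙 (x₃ ∧ b) ≡ 𝟙 ((x₃ ∨ x₄) ∧ c)
    by-size true  true  _ _ _ excl _   _   = ⊥-elim (excl _ _)
    by-size false true  a b c _    a≡c _   = trans (+-identityʳ _) (cong 𝟙 (a≡c _))
    by-size true  false a b c _    _   b≡c = cong 𝟙 (b≡c _)
    by-size false false _ _ _ _    _   _   = refl

    size-excl : (U : Subset n) → T (∣ U ∣ ≡ᵇ 4) → ¬ T (∣ U ∣ ≡ᵇ 3)
    size-excl U is4 is3 with trans (sym (≡ᵇ⇒≡ ∣ U ∣ 4 is4)) (≡ᵇ⇒≡ ∣ U ∣ 3 is3)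
    ... | ()

    count-by-size : (f : Subset (suc n) → Bool) (g : Subset n → Bool) → (∀ b U → ∣ b ∷ U ∣ ≡ 4 → f (b ∷ U) ≡ g U) →
                    countSubsets (λ Q → ofSize 4 Q ∧ f Q) ≡ countSubsets (λ U → P₃₄ U ∧ g U)
    count-by-size f g f≡g = trans (countSubsets-suc (λ Q → ofSize 4 Q ∧ f Q)) (trans (∑-cong (subsets n) (λ U _ →
        by-size (∣ U ∣ ≡ᵇ 3) (∣ U ∣ ≡ᵇ 4) (f (false ∷ U)) (f (true ∷ U)) (g U) (size-excl U)
                (λ is4 → f≡g false U (≡ᵇ⇒≡ ∣ U ∣ 4 is4)) (λ is3 → f≡g true U (cong suc (≡ᵇ⇒≡ ∣ U ∣ 3 is3)))))
      (sym (length-filter≡∑𝟙 (λ U → P₃₄ U ∧ g U) (subsets n))))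

  resolved≡ : (H : Clusters n) (b : Bool) (U : Subset n) → ∣ b ∷ U ∣ ≡ 4 → resolved H (b ∷ U) ≡ resolvesᵇ H U
  resolved≡ H b U ∣Q∣≡4 = ⇔-same⇒≡ (T-resolved H b U ∣Q∣≡4) (T-resolvesᵇ H U)

  #D≡ : (H₁ H₂ : Clusters n) → #D H₁ H₂ ≡ #Disagree P₃₄ P₃₄⇒unit H₁ H₂
  #D≡ H₁ H₂ = count-by-size (λ Q → resolved H₁ Q ∧ resolved H₂ Q ∧ not (sameRestriction H₁ H₂ Q))
                            (λ U → resolvesᵇ H₁ U ∧ resolvesᵇ H₂ U ∧ not (agreeᵇ H₁ H₂ U)) λ b U ∣Q∣≡4 →
    trans (cong₂ (λ r₁ r₂ → r₁ ∧ r₂ ∧ not (sameRestriction H₁ H₂ (b ∷ U))) (resolved≡ H₁ b U ∣Q∣≡4) (resolved≡ H₂ b U ∣Q∣≡4))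
          (cong (λ s → resolvesᵇ H₁ U ∧ resolvesᵇ H₂ U ∧ not s)
            (⇔-same⇒≡ (T-sameRestriction H₁ H₂ b U ∣Q∣≡4) (T-agreeᵇ H₁ H₂ U)))

  #R₁≡ : (H₁ H₂ : Clusters n) → #R₁ H₁ H₂ ≡ #OnlyIn P₃₄ P₃₄⇒unit H₁ H₂
  #R₁≡ H₁ H₂ = count-by-size (λ Q → resolved H₁ Q ∧ not (resolved H₂ Q)) (λ U → resolvesᵇ H₁ U ∧ not (resolvesᵇ H₂ U))
                             λ b U ∣Q∣≡4 →
    cong₂ (λ r₁ r₂ → r₁ ∧ not r₂) (resolved≡ H₁ b U ∣Q∣≡4) (resolved≡ H₂ b U ∣Q∣≡4)


lemma8 : ((n : ℕ) (T₁ T₂ : Clusters n) →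
    isHierarchy T₁ ≡ true → isHierarchy T₂ ≡ true →
    3 * Triplet.dHaus T₁ T₂ ≥
    3 * Triplet.#D T₁ T₂ + 2 * (Triplet.#R₁ T₁ T₂ ⊔ Triplet.#R₂ T₁ T₂))
    ×
    ((n : ℕ) (T₁ T₂ : Clusters n) →
    isHierarchy T₁ ≡ true → isHierarchy T₂ ≡ true →
    3 * Quartet.dHaus T₁ T₂ ≥
    3 * Quartet.#D T₁ T₂ + 2 * (Quartet.#R₁ T₁ T₂ ⊔ Quartet.#R₂ T₁ T₂))
lemma8 = (λ n → hausdorff-bound-transfer P₃ P₃⇒unit Triplet.#D Triplet.#R₁ TripletCounts.#D≡ TripletCounts.#R₁≡)
       , (λ n → hausdorff-bound-transfer P₃₄ P₃₄⇒unit Quartet.#D Quartet.#R₁ QuartetCounts.#D≡ QuartetCounts.#R₁≡)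
  where
  open TripletCounts using (P₃; P₃⇒unit)
  open QuartetCounts using (P₃₄; P₃₄⇒unit)
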